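{- In the formal double Eisenstein space: (i) For every even $k\ge4$, in $\mathcal{DE}_k$, $$G\binom{k-1}{1}=\frac{k+1}{2}G\binom{k}{0}-\sum_{\substack{k_1+k_2=k\\ k_1,k_2\ge2\text{ even}}}P\binom{k_1,k_2}{0,0}.$$ (ii) For every even $k\ge6$, in $\mathcal{DE}_k$, $$\frac{(k+1)(k-1)(k-6)}{12}G\binom{k}{0}=\sum_{\substack{k_1+k_2=k\\ k_1,k_2\ge4\text{ even}}}(k_1-1)(k_2-1)\,P\binom{k_1,k_2}{0,0}.$$
   Context: Binomial coefficients $\binom{n}{m}$ are $0$ unless $0\le m\le n$. The formal double Eisenstein space of weight $K\ge1$ is the $\mathbb{Q}$-vector space $\mathcal{DE}_K$ spanned by formal symbols $G\binom{k}{d}$, $G\binom{k_1,k_2}{d_1,d_2}$, $P\binom{k_1,k_2}{d_1,d_2}$ with $k+d=k_1+k_2+d_1+d_2=K$, $k,k_1,k_2\ge1$, $d,d_1,d_2\ge0$ (symbols with upper and lower indices, not binomial coefficients), modulo the relations, for all such $k_1,k_2,d_1,d_2$: \begin{align*} P\binom{k_1,k_2}{d_1,d_2} &= G\binom{k_1,k_2}{d_1,d_2}+G\binom{k_2,k_1}{d_2,d_1}+G\binom{k_1+k_2}{d_1+d_2}\\ &= \sum_{\substack{l_1+l_2=k_1+k_2,\ e_1+e_2=d_1+d_2\\ l_1,l_2\ge1,\ e_1,e_2\ge0}}\left(\binom{l_1-1}{k_1-1}\binom{d_1}{e_1}(-1)^{d_1-e_1}+\binom{l_1-1}{k_2-1}\binom{d_2}{e_1}(-1)^{d_2-e_1}\right)G\binom{l_1,l_2}{e_1,e_2}\\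 &\quad+\frac{d_1!\,d_2!}{(d_1+d_2+1)!}\binom{k_1+k_2-2}{k_1-1}G\binom{k_1+k_2-1}{d_1+d_2+1}. \end{align*} -}

module Defs where

open import Data.Nat as ℕ using (ℕ; zero; suc; _≤_; _∸_; _!; _≟_)
open import Data.Nat.Combinatorics using (_C_)
open import Data.Nat.Properties using (_!≢0)
open import Data.Nat.Divisibility using (_∣?_)
open import Data.Integer as ℤ using (ℤ; +_)
open import Data.Rational using (ℚ; 0ℚ; 1ℚ; _+_; _*_; _-_; -_; _/_)
open import Data.List using (List; []; _∷_; _++_; map; concatMap; filter; upTo)
open import Data.Product using (_×_; _,_; ∃)
open import Data.Bool using (if_then_else_)
open import Relation.Nullary using (does)
open import Relation.Binary.PropositionalEquality using (_≡_)

-- Basis symbols of the free ℚ-vector space underlying the formal double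
-- Eisenstein space:  G¹ k d = G(k;d),  G² k₁ k₂ d₁ d₂ = G(k₁,k₂;d₁,d₂),
-- Pˢ k₁ k₂ d₁ d₂ = P(k₁,k₂;d₁,d₂).
data Sym : Set where
  G¹ : ℕ → ℕ → Sym
  G² : ℕ → ℕ → ℕ → ℕ → Sym
  Pˢ : ℕ → ℕ → ℕ → ℕ → Sym

_≟ˢ_ : Sym → Sym → Data.Bool.Bool
G¹ a b ≟ˢ G¹ a' b' = does (a ≟ a') Data.Bool.∧ does (b ≟ b')
G² a b c d ≟ˢ G² a' b' c' d' =
  does (a ≟ a') Data.Bool.∧ does (b ≟ b') Data.Bool.∧ does (c ≟ c') Data.Bool.∧ does (d ≟ d')
Pˢ a b c d ≟ˢ Pˢ a' b' c' d' =
  does (a ≟ a') Data.Bool.∧ does (b ≟ b') Data.Bool.∧ does (c ≟ c') Data.Bool.∧ does (d ≟ d')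
_ ≟ˢ _ = Data.Bool.false

FSum : Set
FSum = List (ℚ × Sym)

coeff : FSum → Sym → ℚ
coeff [] s = 0ℚ
coeff ((c , t) ∷ xs) s = (if t ≟ˢ s then c else 0ℚ) + coeff xs s

⟦_⟧ : Sym → FSum
⟦ s ⟧ = (1ℚ , s) ∷ []

_·_ : ℚ → FSum → FSum
c · xs = map (λ { (a , s) → (c * a , s) }) xs

infixl 6 _⊕_ _⊖_
infixr 7 _·_

_⊕_ : FSum → FSum → FSum
_⊕_ = _++_

_⊖_ : FSum → FSum → FSum
x ⊖ y = x ++ ((- 1ℚ) · y)

Σ[_]_ : {A : Set} → List A → (A → FSum) → FSum
Σ[ xs ] f = concatMap f xs

ℕ→ℚ : ℕ → ℚ
ℕ→ℚ n = + n / 1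

ℤ→ℚ : ℤ → ℚ
ℤ→ℚ z = z / 1

sgn : ℕ → ℚ
sgn zero = 1ℚ
sgn (suc n) = - sgn n

-- range [a, b] of naturals (empty if b < a)
range : ℕ → ℕ → List ℕ
range a b = map (a ℕ.+_) (upTo (suc b ∸ a))

factRatio : ℕ → ℕ → ℚ
factRatio d₁ d₂ = (+ (d₁ ! ℕ.* d₂ !)) / (suc (d₁ ℕ.+ d₂)) !
  where instance _ = (suc (d₁ ℕ.+ d₂)) !≢0

harmonicSide : ℕ → ℕ → ℕ → ℕ → FSum
harmonicSide k₁ k₂ d₁ d₂ =
  ⟦ G² k₁ k₂ d₁ d₂ ⟧ ⊕ ⟦ G² k₂ k₁ d₂ d₁ ⟧ ⊕ ⟦ G¹ (k₁ ℕ.+ k₂) (d₁ ℕ.+ d₂) ⟧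

shuffleSide : ℕ → ℕ → ℕ → ℕ → FSum
shuffleSide k₁ k₂ d₁ d₂ =
  (Σ[ range 1 (k₁ ℕ.+ k₂ ∸ 1) ] λ l₁ → Σ[ range 0 (d₁ ℕ.+ d₂) ] λ e₁ →
     ( ℕ→ℚ (((l₁ ∸ 1) C (k₁ ∸ 1)) ℕ.* (d₁ C e₁)) * sgn (d₁ ∸ e₁)
     + ℕ→ℚ (((l₁ ∸ 1) C (k₂ ∸ 1)) ℕ.* (d₂ C e₁)) * sgn (d₂ ∸ e₁))
     · ⟦ G² l₁ (k₁ ℕ.+ k₂ ∸ l₁) e₁ (d₁ ℕ.+ d₂ ∸ e₁) ⟧)
  ⊕ (factRatio d₁ d₂ * ℕ→ℚ ((k₁ ℕ.+ k₂ ∸ 2) C (k₁ ∸ 1)))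
     · ⟦ G¹ (k₁ ℕ.+ k₂ ∸ 1) (suc (d₁ ℕ.+ d₂)) ⟧

data RelIx (K : ℕ) : Set where
  rel₁ rel₂ : (k₁ k₂ d₁ d₂ : ℕ) → 1 ≤ k₁ → 1 ≤ k₂ →
              k₁ ℕ.+ k₂ ℕ.+ d₁ ℕ.+ d₂ ≡ K → RelIx K

relVec : ∀ {K} → RelIx K → FSum
relVec (rel₁ k₁ k₂ d₁ d₂ _ _ _) = ⟦ Pˢ k₁ k₂ d₁ d₂ ⟧ ⊖ harmonicSide k₁ k₂ d₁ d₂
relVec (rel₂ k₁ k₂ d₁ d₂ _ _ _) = harmonicSide k₁ k₂ d₁ d₂ ⊖ shuffleSide k₁ k₂ d₁ d₂

-- Equality in the formal double Eisenstein space DE_K: the difference of the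
-- two formal sums is a finite ℚ-linear combination of the relations of weight K
-- (equality of coefficients of every basis symbol).
infix 4 _≈[_]_
_≈[_]_ : FSum → ℕ → FSum → Set
x ≈[ K ] y = ∃ λ (cs : List (ℚ × RelIx K)) → ∀ (s : Sym) →
  coeff (x ⊖ y) s ≡ coeff (Σ[ cs ] (λ { (c , r) → c · relVec r })) s

evensIn : ℕ → ℕ → List ℕ
evensIn a b = filter (2 ∣?_) (range a b)

{-# OPTIONS --safe #-}
-- Both identities are explicit ℚ-linear combinations of the relations with d₁ = d₂ = 0 in weight
-- K = N + 2.  Write Gⱼ = G(j+1, N+1−j; 0, 0), Pⱼ = P(j+1, N+1−j; 0, 0) and Hⱼ = Gⱼ + G_{N−j} + G(K; 0).
-- The relations read Pⱼ = Hⱼ and Hⱼ = Σᵢ (C(i, j) + C(i, N−j)) Gᵢ + C(N, j) G(K−1; 1).  Taking Σ aⱼ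
-- times the first and Σ bⱼ times the second with symmetric weights, every Gᵢ cancels as soon as
-- Σⱼ bⱼ C(i, j) = bᵢ − aᵢ, leaving Σ aⱼ Pⱼ + Σ (bⱼ − aⱼ) G(K; 0) − (b_N − a_N) G(K−1; 1).  With aⱼ the
-- coefficient of Pⱼ in the identity, bⱼ is (−1)ʲ times a polynomial in j plus corrections at the ends;
-- the balance condition then follows from Σⱼ (−1)ʲ j(j−1)⋯(j−r+1) C(i, j) = (−1)ʳ r! [i = r], and the
-- two remaining coefficients are evaluated in closed form.
module Submission where

open import Defs

module DoubleEisensteinRelations where

  open import Algebra.Bundles using (Ring)
  open import Data.Bool using (Bool; true; false; if_then_else_; _∧_)
  open import Data.Bool.Properties using (∧-zeroʳ; ∧-identityʳ)
  open import Data.Fin as Fin using (Fin; toℕ)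
  open import Data.Fin.Permutation using (reverse)
  open import Data.Fin.Properties using (opposite-prop; toℕ≤pred[n])
  open import Data.Integer as ℤ using ()
  import Data.Integer.Properties as ℤₚ
  open import Data.List using (List; []; _∷_; _++_; map; filter; applyUpTo; tabulate)
  open import Data.List.Properties using (concatMap-++)
  open import Data.Nat as ℕ using (ℕ; zero; suc; _≤_; _<_; _∸_; _!; z≤n; s≤s)
  import Data.Nat.Properties as ℕₚ
  open import Data.Nat.Combinatorics using (_C_; nCk+nC[k+1]≡[n+1]C[k+1]; k>n⇒nCk≡0; nCn≡1; nC1≡n; nCk≡nC[n∸k])
  open import Data.Nat.Solver using () renaming (module +-*-Solver to ℕ-Solver)
  open import Data.Nat.Divisibility using (_∣_; _∣?_; divides; ∣m∣n⇒∣m+n)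
  open import Data.Product using (_×_; _,_)
  open import Data.Sum using (_⊎_; inj₁; inj₂)
  open import Data.Rational using (ℚ; 0ℚ; 1ℚ; ½; _+_; _*_; _-_; -_; _/_; fromℚᵘ)
  import Data.Rational.Properties as ℚₚ
  open import Data.Rational.Solver using (module +-*-Solver)
  open import Data.Rational.Unnormalised as ℚᵘ using (mkℚᵘ; *≡*)
  import Data.Rational.Unnormalised.Properties as ℚᵘₚ
  open import Function using (_∘_; id)
  open import Relation.Nullary using (¬_; does; yes; no; contradiction)
  open import Relation.Unary using (Decidable)
  open import Relation.Nullary.Decidable using (dec-true; dec-false)
  open import Relation.Binary.PropositionalEquality
  open import Algebra.Properties.Semiring.Sum (Ring.semiring ℚₚ.+-*-ring)
    using (sum; ∑-distrib-+; ∑-comm; *-distribˡ-sum; ∑-permute; sum-cong-≗)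

  fromℚᵘ-+ : ∀ p q → fromℚᵘ (p ℚᵘ.+ q) ≡ fromℚᵘ p + fromℚᵘ q
  fromℚᵘ-+ p q = ℚₚ.toℚᵘ-injective (ℚᵘₚ.≃-trans (ℚₚ.toℚᵘ-fromℚᵘ (p ℚᵘ.+ q)) (ℚᵘₚ.≃-sym (ℚᵘₚ.≃-trans
    (ℚₚ.toℚᵘ-homo-+ (fromℚᵘ p) (fromℚᵘ q)) (ℚᵘₚ.+-cong (ℚₚ.toℚᵘ-fromℚᵘ p) (ℚₚ.toℚᵘ-fromℚᵘ q)))))

  fromℚᵘ-* : ∀ p q → fromℚᵘ (p ℚᵘ.* q) ≡ fromℚᵘ p * fromℚᵘ q
  fromℚᵘ-* p q = ℚₚ.toℚᵘ-injective (ℚᵘₚ.≃-trans (ℚₚ.toℚᵘ-fromℚᵘ (p ℚᵘ.* q)) (ℚᵘₚ.≃-sym (ℚᵘₚ.≃-trans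
    (ℚₚ.toℚᵘ-homo-* (fromℚᵘ p) (fromℚᵘ q)) (ℚᵘₚ.*-cong (ℚₚ.toℚᵘ-fromℚᵘ p) (ℚₚ.toℚᵘ-fromℚᵘ q)))))

  ℕ→ℚ-+ : ∀ m n → ℕ→ℚ (m ℕ.+ n) ≡ ℕ→ℚ m + ℕ→ℚ n
  ℕ→ℚ-+ m n = trans (ℚₚ.fromℚᵘ-cong {mkℚᵘ (ℤ.+ (m ℕ.+ n)) 0} {mkℚᵘ (ℤ.+ m) 0 ℚᵘ.+ mkℚᵘ (ℤ.+ n) 0} (*≡* eq))
      (fromℚᵘ-+ (mkℚᵘ (ℤ.+ m) 0) (mkℚᵘ (ℤ.+ n) 0))
    where
    eq : ℤ.+ (m ℕ.+ n) ℤ.* ℤ.+ 1 ≡ (ℤ.+ m ℤ.* ℤ.+ 1 ℤ.+ ℤ.+ n ℤ.* ℤ.+ 1) ℤ.* ℤ.+ 1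
    eq = cong (ℤ._* ℤ.+ 1)
        (trans (ℤₚ.pos-+ m n) (cong₂ ℤ._+_ (sym (ℤₚ.*-identityʳ (ℤ.+ m))) (sym (ℤₚ.*-identityʳ (ℤ.+ n)))))

  ℕ→ℚ-* : ∀ m n → ℕ→ℚ (m ℕ.* n) ≡ ℕ→ℚ m * ℕ→ℚ n
  ℕ→ℚ-* m n = trans (ℚₚ.fromℚᵘ-cong {mkℚᵘ (ℤ.+ (m ℕ.* n)) 0} {mkℚᵘ (ℤ.+ m) 0 ℚᵘ.* mkℚᵘ (ℤ.+ n) 0}
      (*≡* (cong (ℤ._* ℤ.+ 1) (ℤₚ.pos-* m n)))) (fromℚᵘ-* (mkℚᵘ (ℤ.+ m) 0) (mkℚᵘ (ℤ.+ n) 0))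

  ℕ→ℚ-∸ : ∀ {m n} → n ≤ m → ℕ→ℚ (m ∸ n) ≡ ℕ→ℚ m - ℕ→ℚ n
  ℕ→ℚ-∸ {m} {n} n≤m = begin
    ℕ→ℚ (m ∸ n)
        ≡⟨ solve 2 (λ x y → x := (x :+ y) :- y) refl (ℕ→ℚ (m ∸ n)) (ℕ→ℚ n) ⟩
    (ℕ→ℚ (m ∸ n) + ℕ→ℚ n) - ℕ→ℚ n
        ≡⟨ cong (_- ℕ→ℚ n) (sym (ℕ→ℚ-+ (m ∸ n) n)) ⟩
    ℕ→ℚ (m ∸ n ℕ.+ n) - ℕ→ℚ n
        ≡⟨ cong (λ x → ℕ→ℚ x - ℕ→ℚ n) (ℕₚ.m∸n+n≡m n≤m) ⟩
    ℕ→ℚ m - ℕ→ℚ n  ∎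
    where
    open ≡-Reasoning
    open +-*-Solver hiding (⟦_⟧)

  n/[1+d]≡n*1/[1+d] : ∀ n d → ℤ.+ n / suc d ≡ ℕ→ℚ n * (ℤ.+ 1 / suc d)
  n/[1+d]≡n*1/[1+d] n d = trans
      (ℚₚ.fromℚᵘ-cong {mkℚᵘ (ℤ.+ n) d} {mkℚᵘ (ℤ.+ n) 0 ℚᵘ.* mkℚᵘ (ℤ.+ 1) d} (*≡* eq))
          (fromℚᵘ-* (mkℚᵘ (ℤ.+ n) 0) (mkℚᵘ (ℤ.+ 1) d))
    where
    eq : ℤ.+ n ℤ.* ℤ.+ (1 ℕ.* suc d) ≡ (ℤ.+ n ℤ.* ℤ.+ 1) ℤ.* ℤ.+ suc d
    eq = cong₂ ℤ._*_ (sym (ℤₚ.*-identityʳ (ℤ.+ n))) (cong ℤ.+_ (ℕₚ.*-identityˡ (suc d)))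

  ℕ→ℚ[n*[n∸1]] : ∀ n → ℕ→ℚ (n ℕ.* (n ∸ 1)) ≡ ℕ→ℚ n * (ℕ→ℚ n - 1ℚ)
  ℕ→ℚ[n*[n∸1]] zero    = refl
  ℕ→ℚ[n*[n∸1]] (suc n) = begin
    ℕ→ℚ (suc n ℕ.* n)
        ≡⟨ ℕ→ℚ-* (suc n) n ⟩
    ℕ→ℚ (suc n) * ℕ→ℚ n
        ≡⟨ cong (λ x → x * ℕ→ℚ n) (ℕ→ℚ-+ 1 n) ⟩
    (1ℚ + ℕ→ℚ n) * ℕ→ℚ n
        ≡⟨ solve 1 (λ x → (con 1ℚ :+ x) :* x := (con 1ℚ :+ x) :* ((con 1ℚ :+ x) :- con 1ℚ)) refl (ℕ→ℚ n) ⟩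
    (1ℚ + ℕ→ℚ n) * ((1ℚ + ℕ→ℚ n) - 1ℚ)
        ≡⟨ cong (λ x → x * (x - 1ℚ)) (sym (ℕ→ℚ-+ 1 n)) ⟩
    ℕ→ℚ (suc n) * (ℕ→ℚ (suc n) - 1ℚ)  ∎
    where
    open ≡-Reasoning
    open +-*-Solver hiding (⟦_⟧)

  ℕ→ℚ[j*[N∸j]] : ∀ {N j} → j ≤ N → ℕ→ℚ (j ℕ.* (N ∸ j)) ≡ ℕ→ℚ j * (ℕ→ℚ N - ℕ→ℚ j)
  ℕ→ℚ[j*[N∸j]] {N} {j} j≤N = trans (ℕ→ℚ-* j (N ∸ j)) (cong (ℕ→ℚ j *_) (ℕ→ℚ-∸ j≤N))

  -- Finite sums over [0, n)

  ∑< : ℕ → (ℕ → ℚ) → ℚ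
  ∑< zero    f = 0ℚ
  ∑< (suc n) f = f 0 + ∑< n (f ∘ suc)

  ∑<≡sum : ∀ n (f : ℕ → ℚ) → ∑< n f ≡ sum {n} (f ∘ toℕ)
  ∑<≡sum zero    f = refl
  ∑<≡sum (suc n) f = cong (f 0 +_) (∑<≡sum n (f ∘ suc))

  ∑<-cong : ∀ n {f g : ℕ → ℚ} → (∀ j → j < n → f j ≡ g j) → ∑< n f ≡ ∑< n g
  ∑<-cong zero    f≗g = refl
  ∑<-cong (suc n) f≗g = cong₂ _+_ (f≗g 0 (s≤s z≤n)) (∑<-cong n (λ j j<n → f≗g (suc j) (s≤s j<n)))

  ∑<-zero : ∀ n → ∑< n (λ _ → 0ℚ) ≡ 0ℚ
  ∑<-zero zero    = refl
  ∑<-zero (suc n) = trans (ℚₚ.+-identityˡ _) (∑<-zero n)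

  ∑<-const : ∀ n c → ∑< n (λ _ → c) ≡ ℕ→ℚ n * c
  ∑<-const zero    c = sym (ℚₚ.*-zeroˡ c)
  ∑<-const (suc n) c = begin
    c + ∑< n (λ _ → c)      ≡⟨ cong (c +_) (∑<-const n c) ⟩
    c + ℕ→ℚ n * c           ≡⟨ solve 2 (λ c x → c :+ x :* c := (con 1ℚ :+ x) :* c) refl c (ℕ→ℚ n) ⟩
    (1ℚ + ℕ→ℚ n) * c        ≡⟨ cong (_* c) (sym (ℕ→ℚ-+ 1 n)) ⟩
    ℕ→ℚ (suc n) * c         ∎
    where
    open ≡-Reasoning
    open +-*-Solver hiding (⟦_⟧)

  ∑<-last : ∀ n (f : ℕ → ℚ) → ∑< (suc n) f ≡ ∑< n f + f n
  ∑<-last zero    f = trans (ℚₚ.+-identityʳ (f 0)) (sym (ℚₚ.+-identityˡ (f 0)))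
  ∑<-last (suc n) f = trans (cong (f 0 +_) (∑<-last n (f ∘ suc))) (sym (ℚₚ.+-assoc (f 0) _ _))

  ∑<-telescope : ∀ n (f : ℕ → ℚ) → ∑< n (λ j → f (suc j) - f j) ≡ f n - f 0
  ∑<-telescope zero    f = sym (ℚₚ.+-inverseʳ (f 0))
  ∑<-telescope (suc n) f = begin
    (f 1 - f 0) + ∑< n (λ j → f (suc (suc j)) - f (suc j))
        ≡⟨ cong ((f 1 - f 0) +_) (∑<-telescope n (f ∘ suc)) ⟩
    (f 1 - f 0) + (f (suc n) - f 1)
        ≡⟨ solve 3 (λ a b c → (b :- a) :+ (c :- b) := c :- a) refl (f 0) (f 1) (f (suc n)) ⟩
    f (suc n) - f 0  ∎
    where
    open ≡-Reasoning
    open +-*-Solver hiding (⟦_⟧)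

  ∑<-distrib-+ : ∀ n (f g : ℕ → ℚ) → ∑< n (λ j → f j + g j) ≡ ∑< n f + ∑< n g
  ∑<-distrib-+ n f g = begin
    ∑< n (λ j → f j + g j)               ≡⟨ ∑<≡sum n _ ⟩
    sum {n} (λ i → f (toℕ i) + g (toℕ i))    ≡⟨ ∑-distrib-+ {n} (f ∘ toℕ) (g ∘ toℕ) ⟩
    sum {n} (f ∘ toℕ) + sum {n} (g ∘ toℕ)        ≡⟨ sym (cong₂ _+_ (∑<≡sum n f) (∑<≡sum n g)) ⟩
    ∑< n f + ∑< n g                      ∎
    where open ≡-Reasoning

  ∑<-distrib-- : ∀ n (f g : ℕ → ℚ) → ∑< n (λ j → f j - g j) ≡ ∑< n f - ∑< n g
  ∑<-distrib-- n f g = begin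
    ∑< n (λ j → f j - g j)
        ≡⟨ solve 2 (λ x y → x := (x :+ y) :- y) refl (∑< n (λ j → f j - g j)) (∑< n g) ⟩
    (∑< n (λ j → f j - g j) + ∑< n g) - ∑< n g
        ≡⟨ cong (_- ∑< n g) (sym (∑<-distrib-+ n (λ j → f j - g j) g)) ⟩
    ∑< n (λ j → (f j - g j) + g j) - ∑< n g
        ≡⟨ cong (_- ∑< n g) (∑<-cong n (λ j _ → solve 2 (λ x y → (x :- y) :+ y := x) refl (f j) (g j))) ⟩
    ∑< n f - ∑< n g  ∎
    where
    open ≡-Reasoning
    open +-*-Solver hiding (⟦_⟧)

  *-distribˡ-∑< : ∀ n c (f : ℕ → ℚ) → c * ∑< n f ≡ ∑< n (λ j → c * f j)
  *-distribˡ-∑< n c f = begin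
    c * ∑< n f                  ≡⟨ cong (c *_) (∑<≡sum n f) ⟩
    c * sum {n} (f ∘ toℕ)           ≡⟨ *-distribˡ-sum {n} c (f ∘ toℕ) ⟩
    sum {n} (λ i → c * f (toℕ i))   ≡⟨ sym (∑<≡sum n _) ⟩
    ∑< n (λ j → c * f j)        ∎
    where open ≡-Reasoning

  *-distribʳ-∑< : ∀ n c (f : ℕ → ℚ) → ∑< n f * c ≡ ∑< n (λ j → f j * c)
  *-distribʳ-∑< n c f = trans (ℚₚ.*-comm (∑< n f) c)
    (trans (*-distribˡ-∑< n c f) (∑<-cong n (λ j _ → ℚₚ.*-comm c (f j))))

  ∑<-neg : ∀ n (f : ℕ → ℚ) → ∑< n (λ j → - f j) ≡ - ∑< n f
  ∑<-neg n f = begin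
    ∑< n (λ j → - f j)          ≡⟨ ∑<-cong n (λ j _ → neg≡-1* (f j)) ⟩
    ∑< n (λ j → - 1ℚ * f j)     ≡⟨ sym (*-distribˡ-∑< n (- 1ℚ) f) ⟩
    - 1ℚ * ∑< n f               ≡⟨ sym (neg≡-1* (∑< n f)) ⟩
    - ∑< n f                    ∎
    where
    open ≡-Reasoning
    open +-*-Solver hiding (⟦_⟧)
    neg≡-1* : ∀ x → - x ≡ - 1ℚ * x
    neg≡-1* = solve 1 (λ x → :- x := (:- con 1ℚ) :* x) refl

  ∑<-linear : ∀ n α β (f g h : ℕ → ℚ) →
              ∑< n (λ j → α * f j + β * g j - h j) ≡ α * ∑< n f + β * ∑< n g - ∑< n h
  ∑<-linear n α β f g h = begin
    ∑< n (λ j → α * f j + β * g j - h j)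
        ≡⟨ ∑<-distrib-- n (λ j → α * f j + β * g j) h ⟩
    ∑< n (λ j → α * f j + β * g j) - ∑< n h
        ≡⟨ cong (_- ∑< n h) (∑<-distrib-+ n (λ j → α * f j) (λ j → β * g j)) ⟩
    ∑< n (λ j → α * f j) + ∑< n (λ j → β * g j) - ∑< n h
        ≡⟨ cong₂ (λ x y → x + y - ∑< n h) (sym (*-distribˡ-∑< n α f)) (sym (*-distribˡ-∑< n β g)) ⟩
    α * ∑< n f + β * ∑< n g - ∑< n h  ∎
    where open ≡-Reasoning

  ∑<-comm : ∀ m n (f : ℕ → ℕ → ℚ) → ∑< m (λ i → ∑< n (f i)) ≡ ∑< n (λ j → ∑< m (λ i → f i j))
  ∑<-comm m n f = begin
    ∑< m (λ i → ∑< n (f i))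
        ≡⟨ ∑<-cong m (λ i _ → ∑<≡sum n (f i)) ⟩
    ∑< m (λ i → sum {n} (f i ∘ toℕ))
        ≡⟨ ∑<≡sum m _ ⟩
    sum {m} (λ i → sum {n} (λ j → f (toℕ i) (toℕ j)))
        ≡⟨ ∑-comm {m} {n} (λ i j → f (toℕ i) (toℕ j)) ⟩
    sum {n} (λ j → sum {m} (λ i → f (toℕ i) (toℕ j)))
        ≡⟨ sym (∑<≡sum n _) ⟩
    ∑< n (λ j → sum {m} (λ i → f (toℕ i) j))
        ≡⟨ sym (∑<-cong n (λ j _ → ∑<≡sum m (λ i → f i j))) ⟩
    ∑< n (λ j → ∑< m (λ i → f i j))  ∎
    where open ≡-Reasoning

  ∑<-reverse : ∀ N (f : ℕ → ℚ) → ∑< (suc N) (λ j → f (N ∸ j)) ≡ ∑< (suc N) f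
  ∑<-reverse N f = begin
    ∑< (suc N) (λ j → f (N ∸ j))
        ≡⟨ ∑<≡sum (suc N) (λ j → f (N ∸ j)) ⟩
    sum {suc N} (λ i → f (N ∸ toℕ i))
        ≡⟨ sum-cong-≗ {suc N} (λ i → cong f (sym (opposite-prop i))) ⟩
    sum {suc N} (λ i → f (toℕ (Fin.opposite i)))
        ≡⟨ sym (∑-permute (f ∘ toℕ) reverse) ⟩
    sum {suc N} (f ∘ toℕ)
        ≡⟨ sym (∑<≡sum (suc N) f) ⟩
    ∑< (suc N) f  ∎
    where open ≡-Reasoning

  ∑<-mirror : ∀ N {w : ℕ → ℚ} (f : ℕ → ℚ) → (∀ {j} → j ≤ N → w (N ∸ j) ≡ w j) →
              ∑< (suc N) (λ j → w j * f (N ∸ j)) ≡ ∑< (suc N) (λ j → w j * f j)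
  ∑<-mirror N {w} f w-symmetric = begin
    ∑< (suc N) (λ j → w j * f (N ∸ j))
        ≡⟨ ∑<-cong (suc N) (λ j j≤N → cong (λ i → w i * f (N ∸ j)) (sym (ℕₚ.m∸[m∸n]≡n (ℕₚ.≤-pred j≤N)))) ⟩
    ∑< (suc N) (λ j → w (N ∸ (N ∸ j)) * f (N ∸ j))
        ≡⟨ ∑<-reverse N (λ j → w (N ∸ j) * f j) ⟩
    ∑< (suc N) (λ j → w (N ∸ j) * f j)
        ≡⟨ ∑<-cong (suc N) (λ j j≤N → cong (_* f j) (w-symmetric (ℕₚ.≤-pred j≤N))) ⟩
    ∑< (suc N) (λ j → w j * f j)  ∎
    where open ≡-Reasoning

  𝟙 : Bool → ℚ
  𝟙 b = if b then 1ℚ else 0ℚ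

  δ : ℕ → ℕ → ℚ
  δ p j = 𝟙 (does (p ℕ.≟ j))

  δ-diag : ∀ p → δ p p ≡ 1ℚ
  δ-diag p = cong 𝟙 (dec-true (p ℕ.≟ p) refl)

  δ-≢ : ∀ {p j} → p ≢ j → δ p j ≡ 0ℚ
  δ-≢ {p} {j} p≢j = cong 𝟙 (dec-false (p ℕ.≟ j) p≢j)

  δ-reflect : ∀ {N p j} → p ≤ N → j ≤ N → δ p (N ∸ j) ≡ δ (N ∸ p) j
  δ-reflect {N} {p} {j} p≤N j≤N with p ℕ.≟ N ∸ j
  ... | yes p≡N∸j = begin
    δ p (N ∸ j)        ≡⟨ cong (λ i → δ i (N ∸ j)) p≡N∸j ⟩
    δ (N ∸ j) (N ∸ j)  ≡⟨ δ-diag (N ∸ j) ⟩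
    1ℚ                 ≡⟨ sym (δ-diag j) ⟩
    δ j j              ≡⟨ cong (λ i → δ i j) (sym (ℕₚ.m∸[m∸n]≡n j≤N)) ⟩
    δ (N ∸ (N ∸ j)) j  ≡⟨ cong (λ i → δ (N ∸ i) j) (sym p≡N∸j) ⟩
    δ (N ∸ p) j        ∎
    where open ≡-Reasoning
  ... | no  p≢N∸j = trans (δ-≢ p≢N∸j)
      (sym (δ-≢ {N ∸ p} {j} (λ N∸p≡j → p≢N∸j (trans (sym (ℕₚ.m∸[m∸n]≡n p≤N)) (cong (N ∸_) N∸p≡j)))))

  δ-pair-reflect : ∀ {N p j} → p ≤ N → j ≤ N → δ p (N ∸ j) + δ (N ∸ p) (N ∸ j) ≡ δ p j + δ (N ∸ p) j
  δ-pair-reflect {N} {p} {j} p≤N j≤N = begin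
    δ p (N ∸ j) + δ (N ∸ p) (N ∸ j)
        ≡⟨ cong₂ _+_ (δ-reflect p≤N j≤N) (δ-reflect (ℕₚ.m∸n≤m N p) j≤N) ⟩
    δ (N ∸ p) j + δ (N ∸ (N ∸ p)) j
        ≡⟨ cong (λ i → δ (N ∸ p) j + δ i j) (ℕₚ.m∸[m∸n]≡n p≤N) ⟩
    δ (N ∸ p) j + δ p j
        ≡⟨ ℚₚ.+-comm (δ (N ∸ p) j) (δ p j) ⟩
    δ p j + δ (N ∸ p) j  ∎
    where open ≡-Reasoning

  *-δ : ∀ (f : ℕ → ℚ) r n → f n * δ r n ≡ f r * δ r n
  *-δ f r n with r ℕ.≟ n
  ... | yes refl = refl
  ... | no  r≢n  = trans (cong (f n *_) (δ-≢ r≢n))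
      (trans (ℚₚ.*-zeroʳ (f n)) (sym (trans (cong (f r *_) (δ-≢ r≢n)) (ℚₚ.*-zeroʳ (f r)))))

  ∑<-δ : ∀ {p n} (f : ℕ → ℚ) → p < n → ∑< n (λ j → δ p j * f j) ≡ f p
  ∑<-δ {zero} {suc n} f _ = begin
    1ℚ * f 0 + ∑< n (λ j → 0ℚ * f (suc j))
        ≡⟨ cong₂ _+_ (ℚₚ.*-identityˡ (f 0)) (∑<-cong n (λ j _ → ℚₚ.*-zeroˡ (f (suc j)))) ⟩
    f 0 + ∑< n (λ _ → 0ℚ)
        ≡⟨ cong (λ x → f 0 + x) (∑<-zero n) ⟩
    f 0 + 0ℚ
        ≡⟨ ℚₚ.+-identityʳ (f 0) ⟩
    f 0  ∎
    where open ≡-Reasoning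
  ∑<-δ {suc p} {suc n} f (s≤s p<n) = begin
    0ℚ * f 0 + ∑< n (λ j → δ p j * f (suc j))
        ≡⟨ cong (_+ ∑< n (λ j → δ p j * f (suc j))) (ℚₚ.*-zeroˡ (f 0)) ⟩
    0ℚ + ∑< n (λ j → δ p j * f (suc j))
        ≡⟨ ℚₚ.+-identityˡ _ ⟩
    ∑< n (λ j → δ p j * f (suc j))
        ≡⟨ ∑<-δ (f ∘ suc) p<n ⟩
    f (suc p)  ∎
    where open ≡-Reasoning

  ∑<-δ₂ : ∀ {p q n} (f : ℕ → ℚ) → p < n → q < n → ∑< n (λ j → (δ p j + δ q j) * f j) ≡ f p + f q
  ∑<-δ₂ {p} {q} {n} f p<n q<n = begin
    ∑< n (λ j → (δ p j + δ q j) * f j)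
        ≡⟨ ∑<-cong n (λ j _ → ℚₚ.*-distribʳ-+ (f j) (δ p j) (δ q j)) ⟩
    ∑< n (λ j → δ p j * f j + δ q j * f j)
        ≡⟨ ∑<-distrib-+ n (λ j → δ p j * f j) (λ j → δ q j * f j) ⟩
    ∑< n (λ j → δ p j * f j) + ∑< n (λ j → δ q j * f j)
        ≡⟨ cong₂ _+_ (∑<-δ f p<n) (∑<-δ f q<n) ⟩
    f p + f q  ∎
    where open ≡-Reasoning

  window : ℕ → ℕ → ℕ → Bool
  window lo hi k = does (lo ℕ.≤? k) ∧ does (k ℕ.≤? hi)

  does-≤?-suc : ∀ m n → does (suc m ℕ.≤? suc n) ≡ does (m ℕ.≤? n)
  does-≤?-suc m n with m ℕ.≤? n
  ... | yes m≤n = trans (dec-true (suc m ℕ.≤? suc n) (s≤s m≤n)) (sym (dec-true (m ℕ.≤? n) m≤n))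
  ... | no  m≰n = trans (dec-false (suc m ℕ.≤? suc n) (m≰n ∘ ℕ.s≤s⁻¹)) (sym (dec-false (m ℕ.≤? n) m≰n))

  ∑<-0* : ∀ n (F : ℕ → ℚ) → ∑< n (λ k → 0ℚ * F k) ≡ 0ℚ
  ∑<-0* n F = trans (∑<-cong n (λ k _ → ℚₚ.*-zeroˡ (F k))) (∑<-zero n)

  ∑<-prefix : ∀ hi n (F : ℕ → ℚ) → hi ≤ n → ∑< (suc hi) F ≡ ∑< (suc n) (λ k → 𝟙 (does (k ℕ.≤? hi)) * F k)
  ∑<-prefix zero n F _ = cong₂ _+_ (sym (ℚₚ.*-identityˡ (F 0))) (sym (∑<-0* n (F ∘ suc)))
  ∑<-prefix (suc hi) (suc n) F (s≤s hi≤n) = cong₂ _+_ (sym (ℚₚ.*-identityˡ (F 0))) (begin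
    ∑< (suc hi) (F ∘ suc)
        ≡⟨ ∑<-prefix hi n (F ∘ suc) hi≤n ⟩
    ∑< (suc n) (λ k → 𝟙 (does (k ℕ.≤? hi)) * F (suc k))
        ≡⟨ ∑<-cong (suc n) (λ k _ → cong (λ b → 𝟙 b * F (suc k)) (sym (does-≤?-suc k hi))) ⟩
    ∑< (suc n) (λ k → 𝟙 (does (suc k ℕ.≤? suc hi)) * F (suc k))  ∎)
    where open ≡-Reasoning

  ∑<-window : ∀ lo hi n (F : ℕ → ℚ) → hi ≤ n →
              ∑< (suc hi ∸ lo) (λ i → F (lo ℕ.+ i)) ≡ ∑< (suc n) (λ k → 𝟙 (window lo hi k) * F k)
  ∑<-window zero hi n F hi≤n = ∑<-prefix hi n F hi≤n
  ∑<-window (suc lo) zero n F _ = begin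
    ∑< (0 ∸ lo) (λ i → F (suc lo ℕ.+ i))
        ≡⟨ cong (λ m → ∑< m (λ i → F (suc lo ℕ.+ i))) (ℕₚ.0∸n≡0 lo) ⟩
    0ℚ
        ≡⟨ sym (∑<-0* (suc n) F) ⟩
    ∑< (suc n) (λ k → 0ℚ * F k)
        ≡⟨ ∑<-cong (suc n) (λ k _ → cong (λ b → 𝟙 b * F k) (sym (closed k))) ⟩
    ∑< (suc n) (λ k → 𝟙 (window (suc lo) zero k) * F k)  ∎
    where
    open ≡-Reasoning
    closed : ∀ k → window (suc lo) zero k ≡ false
    closed zero    = refl
    closed (suc k) = ∧-zeroʳ (does (suc lo ℕ.≤? suc k))
  ∑<-window (suc lo) (suc hi) (suc n) F (s≤s hi≤n) = begin
    ∑< (suc hi ∸ lo) (λ i → F (suc (lo ℕ.+ i)))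
        ≡⟨ ∑<-window lo hi n (F ∘ suc) hi≤n ⟩
    ∑< (suc n) (λ k → 𝟙 (window lo hi k) * F (suc k))
        ≡⟨ ∑<-cong (suc n) (λ k _ → cong (λ b → 𝟙 b * F (suc k)) (sym (window-suc k))) ⟩
    ∑< (suc n) (λ k → 𝟙 (window (suc lo) (suc hi) (suc k)) * F (suc k))
        ≡⟨ sym (ℚₚ.+-identityˡ _) ⟩
    0ℚ + ∑< (suc n) (λ k → 𝟙 (window (suc lo) (suc hi) (suc k)) * F (suc k))
        ≡⟨ cong (_+ ∑< (suc n) (λ k → 𝟙 (window (suc lo) (suc hi) (suc k)) * F (suc k))) (sym (ℚₚ.*-zeroˡ (F 0))) ⟩
    ∑< (suc (suc n)) (λ k → 𝟙 (window (suc lo) (suc hi) k) * F k)  ∎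
    where
    open ≡-Reasoning
    window-suc : ∀ k → window (suc lo) (suc hi) (suc k) ≡ window lo hi k
    window-suc k = cong₂ _∧_ (does-≤?-suc lo k) (does-≤?-suc k hi)

  evenWindow : ℕ → ℕ → ℕ → ℚ
  evenWindow lo hi k = 𝟙 (window lo hi k) * 𝟙 (does (2 ∣? k))

  sgn-+ : ∀ m n → sgn (m ℕ.+ n) ≡ sgn m * sgn n
  sgn-+ zero    n = sym (ℚₚ.*-identityˡ (sgn n))
  sgn-+ (suc m) n = trans (cong -_ (sgn-+ m n)) (ℚₚ.neg-distribˡ-* (sgn m) (sgn n))

  sgn*sgn : ∀ n → sgn n * sgn n ≡ 1ℚ
  sgn*sgn zero    = refl
  sgn*sgn (suc n) = trans (solve 1 (λ x → (:- x) :* (:- x) := x :* x) refl (sgn n)) (sgn*sgn n)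
    where open +-*-Solver hiding (⟦_⟧)

  sgn-even : ∀ {n} → 2 ∣ n → sgn n ≡ 1ℚ
  sgn-even (divides q refl) = go q
    where
    go : ∀ q → sgn (q ℕ.* 2) ≡ 1ℚ
    go zero    = refl
    go (suc q) = trans (solve 1 (λ x → :- (:- x) := x) refl (sgn (q ℕ.* 2))) (go q)
      where open +-*-Solver hiding (⟦_⟧)

  sgn-reflect : ∀ {N j} → 2 ∣ N → j ≤ N → sgn (N ∸ j) ≡ sgn j
  sgn-reflect {N} {j} 2∣N j≤N = begin
    sgn (N ∸ j)                        ≡⟨ sym (ℚₚ.*-identityʳ (sgn (N ∸ j))) ⟩
    sgn (N ∸ j) * 1ℚ                   ≡⟨ sym (cong (sgn (N ∸ j) *_) (sgn*sgn j)) ⟩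
    sgn (N ∸ j) * (sgn j * sgn j)      ≡⟨ sym (ℚₚ.*-assoc (sgn (N ∸ j)) (sgn j) (sgn j)) ⟩
    sgn (N ∸ j) * sgn j * sgn j        ≡⟨ cong (_* sgn j) (sym (sgn-+ (N ∸ j) j)) ⟩
    sgn (N ∸ j ℕ.+ j) * sgn j          ≡⟨ cong (λ n → sgn n * sgn j) (ℕₚ.m∸n+n≡m j≤N) ⟩
    sgn N * sgn j                      ≡⟨ cong (_* sgn j) (sgn-even 2∣N) ⟩
    1ℚ * sgn j                         ≡⟨ ℚₚ.*-identityˡ (sgn j) ⟩
    sgn j                              ∎
    where open ≡-Reasoning

  𝟙[2∣1+j]≡½[1-sgn[j]] : ∀ j → 𝟙 (does (2 ∣? suc j)) ≡ ½ * (1ℚ - sgn j)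
  𝟙[2∣1+j]≡½[1-sgn[j]] zero          = refl
  𝟙[2∣1+j]≡½[1-sgn[j]] (suc zero)    = refl
  𝟙[2∣1+j]≡½[1-sgn[j]] (suc (suc j)) =
    trans (𝟙[2∣1+j]≡½[1-sgn[j]] j) (cong (λ x → ½ * (1ℚ - x)) (solve 1 (λ x → x := :- (:- x)) refl (sgn j)))
    where open +-*-Solver hiding (⟦_⟧)

  coeff-++ : ∀ xs ys s → coeff (xs ++ ys) s ≡ coeff xs s + coeff ys s
  coeff-++ []              ys s = sym (ℚₚ.+-identityˡ (coeff ys s))
  coeff-++ ((c , t) ∷ xs) ys s =
    trans (cong (c′ +_) (coeff-++ xs ys s)) (sym (ℚₚ.+-assoc c′ (coeff xs s) (coeff ys s)))
    where c′ = if t ≟ˢ s then c else 0ℚ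

  coeff-· : ∀ c xs s → coeff (c · xs) s ≡ c * coeff xs s
  coeff-· c []             s = sym (ℚₚ.*-zeroʳ c)
  coeff-· c ((a , t) ∷ xs) s =
    trans (cong₂ _+_ (scale (t ≟ˢ s)) (coeff-· c xs s)) (sym (ℚₚ.*-distribˡ-+ c _ (coeff xs s)))
    where
    scale : ∀ b → (if b then c * a else 0ℚ) ≡ c * (if b then a else 0ℚ)
    scale true  = refl
    scale false = sym (ℚₚ.*-zeroʳ c)

  coeff-⊖ : ∀ xs ys s → coeff (xs ⊖ ys) s ≡ coeff xs s - coeff ys s
  coeff-⊖ xs ys s = begin
    coeff (xs ⊖ ys) s
        ≡⟨ coeff-++ xs _ s ⟩
    coeff xs s + coeff (- 1ℚ · ys) s
        ≡⟨ cong (coeff xs s +_) (coeff-· (- 1ℚ) ys s) ⟩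
    coeff xs s + - 1ℚ * coeff ys s
        ≡⟨ solve 2 (λ x y → x :+ (:- con 1ℚ) :* y := x :- y) refl (coeff xs s) (coeff ys s) ⟩
    coeff xs s - coeff ys s  ∎
    where
    open ≡-Reasoning
    open +-*-Solver hiding (⟦_⟧)

  coeff-if : ∀ b xs s → coeff (if b then xs else []) s ≡ 𝟙 b * coeff xs s
  coeff-if true  xs s = sym (ℚₚ.*-identityˡ (coeff xs s))
  coeff-if false xs s = sym (ℚₚ.*-zeroˡ (coeff xs s))

  coeff-Σ-tabulate : ∀ {A : Set} n (t : Fin n → A) (f : A → FSum) s →
                     coeff (Σ[ tabulate t ] f) s ≡ sum (λ i → coeff (f (t i)) s)
  coeff-Σ-tabulate zero    t f s = refl
  coeff-Σ-tabulate (suc n) t f s =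
    trans (coeff-++ (f (t Fin.zero)) _ s) (cong (coeff (f (t Fin.zero)) s +_) (coeff-Σ-tabulate n (t ∘ Fin.suc) f s))

  coeff-Σ-range : ∀ lo hi (f : ℕ → FSum) s →
                  coeff (Σ[ range lo hi ] f) s ≡ ∑< (suc hi ∸ lo) (λ i → coeff (f (lo ℕ.+ i)) s)
  coeff-Σ-range lo hi f s = go (suc hi ∸ lo) id
    where
    go : ∀ n (g : ℕ → ℕ) → coeff (Σ[ map (lo ℕ.+_) (applyUpTo g n) ] f) s ≡ ∑< n (λ i → coeff (f (lo ℕ.+ g i)) s)
    go zero    g = refl
    go (suc n) g = trans (coeff-++ (f (lo ℕ.+ g 0)) _ s) (cong (coeff (f (lo ℕ.+ g 0)) s +_) (go n (g ∘ suc)))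

  Σ-filter : ∀ {A : Set} {P : A → Set} (P? : Decidable P) (xs : List A) (f : A → FSum) →
             Σ[ filter P? xs ] f ≡ Σ[ xs ] (λ x → if does (P? x) then f x else [])
  Σ-filter P? []       f = refl
  Σ-filter P? (x ∷ xs) f with does (P? x)
  ... | true  = cong (f x ++_) (Σ-filter P? xs f)
  ... | false = Σ-filter P? xs f

  coeff-Σ-evensIn : ∀ lo hi n (f : ℕ → FSum) s → hi ≤ n →
                    coeff (Σ[ evensIn lo hi ] f) s ≡ ∑< (suc n) (λ k → evenWindow lo hi k * coeff (f k) s)
  coeff-Σ-evensIn lo hi n f s hi≤n = begin
    coeff (Σ[ evensIn lo hi ] f) s
        ≡⟨ cong (λ xs → coeff xs s) (Σ-filter (2 ∣?_) (range lo hi) f) ⟩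
    coeff (Σ[ range lo hi ] (λ k → if does (2 ∣? k) then f k else [])) s
        ≡⟨ coeff-Σ-range lo hi _ s ⟩
    ∑< (suc hi ∸ lo) (λ i → coeff (if does (2 ∣? (lo ℕ.+ i)) then f (lo ℕ.+ i) else []) s)
        ≡⟨ ∑<-cong (suc hi ∸ lo) (λ i _ → coeff-if (does (2 ∣? (lo ℕ.+ i))) (f (lo ℕ.+ i)) s) ⟩
    ∑< (suc hi ∸ lo) (λ i → 𝟙 (does (2 ∣? (lo ℕ.+ i))) * coeff (f (lo ℕ.+ i)) s)
        ≡⟨ ∑<-window lo hi n (λ k → 𝟙 (does (2 ∣? k)) * coeff (f k) s) hi≤n ⟩
    ∑< (suc n) (λ k → 𝟙 (window lo hi k) * (𝟙 (does (2 ∣? k)) * coeff (f k) s))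
        ≡⟨ ∑<-cong (suc n) (λ k _ → sym (ℚₚ.*-assoc (𝟙 (window lo hi k)) (𝟙 (does (2 ∣? k))) (coeff (f k) s))) ⟩
    ∑< (suc n) (λ k → evenWindow lo hi k * coeff (f k) s)  ∎
    where open ≡-Reasoning

  coeff-Σ-evensIn-suc : ∀ lo hi N (f : ℕ → FSum) s → hi ≤ suc N →
    coeff (Σ[ evensIn (suc lo) hi ] f) s ≡ ∑< (suc N) (λ j → evenWindow (suc lo) hi (suc j) * coeff (f (suc j)) s)
  coeff-Σ-evensIn-suc lo hi N f s hi≤1+N = begin
    coeff (Σ[ evensIn (suc lo) hi ] f) s
        ≡⟨ coeff-Σ-evensIn (suc lo) hi (suc N) f s hi≤1+N ⟩
    0ℚ * coeff (f 0) s + ∑< (suc N) (λ j → evenWindow (suc lo) hi (suc j) * coeff (f (suc j)) s)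
        ≡⟨ cong (_+ ∑< (suc N) (λ j → evenWindow (suc lo) hi (suc j) * coeff (f (suc j)) s))
            (ℚₚ.*-zeroˡ (coeff (f 0) s)) ⟩
    0ℚ + ∑< (suc N) (λ j → evenWindow (suc lo) hi (suc j) * coeff (f (suc j)) s)
        ≡⟨ ℚₚ.+-identityˡ _ ⟩
    ∑< (suc N) (λ j → evenWindow (suc lo) hi (suc j) * coeff (f (suc j)) s)  ∎
    where open ≡-Reasoning

  -- Binomial coefficients

  binom : ℕ → ℕ → ℚ
  binom n k = ℕ→ℚ (n C k)

  binom-pascal : ∀ n k → binom (suc n) (suc k) ≡ binom n k + binom n (suc k)
  binom-pascal n k = trans (cong ℕ→ℚ (sym (nCk+nC[k+1]≡[n+1]C[k+1] n k))) (ℕ→ℚ-+ (n C k) (n C suc k))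

  [1+k]*[1+n]C[1+k]≡[1+n]*nCk : ∀ n k → suc k ℕ.* (suc n C suc k) ≡ suc n ℕ.* (n C k)
  [1+k]*[1+n]C[1+k]≡[1+n]*nCk zero    zero    = refl
  [1+k]*[1+n]C[1+k]≡[1+n]*nCk zero    (suc k) = ℕₚ.*-zeroʳ (suc (suc k))
  [1+k]*[1+n]C[1+k]≡[1+n]*nCk (suc n) zero    = trans (ℕₚ.*-identityˡ _)
      (trans (nC1≡n (suc (suc n))) (sym (ℕₚ.*-identityʳ (suc (suc n)))))
  [1+k]*[1+n]C[1+k]≡[1+n]*nCk (suc n) (suc k) = begin
    suc (suc k) ℕ.* (suc (suc n) C suc (suc k))
        ≡⟨ cong (suc (suc k) ℕ.*_) (sym (nCk+nC[k+1]≡[n+1]C[k+1] (suc n) (suc k))) ⟩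
    suc (suc k) ℕ.* (suc n C suc k ℕ.+ suc n C suc (suc k))
        ≡⟨ split (suc k) (suc n C suc k) (suc n C suc (suc k)) ⟩
    suc k ℕ.* (suc n C suc k) ℕ.+ suc n C suc k ℕ.+ suc (suc k) ℕ.* (suc n C suc (suc k))
        ≡⟨ cong₂ (λ a b → a ℕ.+ suc n C suc k ℕ.+ b) ([1+k]*[1+n]C[1+k]≡[1+n]*nCk n k)
            ([1+k]*[1+n]C[1+k]≡[1+n]*nCk n (suc k)) ⟩
    suc n ℕ.* (n C k) ℕ.+ suc n C suc k ℕ.+ suc n ℕ.* (n C suc k)
        ≡⟨ regroup (suc n) (n C k) (n C suc k) (suc n C suc k) ⟩
    suc n ℕ.* (n C k ℕ.+ n C suc k) ℕ.+ suc n C suc k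
        ≡⟨ cong (λ x → suc n ℕ.* x ℕ.+ suc n C suc k) (nCk+nC[k+1]≡[n+1]C[k+1] n k) ⟩
    suc n ℕ.* (suc n C suc k) ℕ.+ suc n C suc k
        ≡⟨ ℕₚ.+-comm (suc n ℕ.* (suc n C suc k)) _ ⟩
    suc (suc n) ℕ.* (suc n C suc k)  ∎
    where
    open ≡-Reasoning
    open ℕ-Solver
    split : ∀ k a b → suc k ℕ.* (a ℕ.+ b) ≡ k ℕ.* a ℕ.+ a ℕ.+ suc k ℕ.* b
    split = solve 3 (λ k a b → (con 1 :+ k) :* (a :+ b) := k :* a :+ a :+ (con 1 :+ k) :* b) refl
    regroup : ∀ m x y z → m ℕ.* x ℕ.+ z ℕ.+ m ℕ.* y ≡ m ℕ.* (x ℕ.+ y) ℕ.+ z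
    regroup = solve 4 (λ m x y z → m :* x :+ z :+ m :* y := m :* (x :+ y) :+ z) refl

  binom-absorb : ∀ n k → ℕ→ℚ (suc k) * binom (suc n) (suc k) ≡ ℕ→ℚ (suc n) * binom n k
  binom-absorb n k = trans (sym (ℕ→ℚ-* (suc k) (suc n C suc k)))
    (trans (cong ℕ→ℚ ([1+k]*[1+n]C[1+k]≡[1+n]*nCk n k)) (ℕ→ℚ-* (suc n) (n C k)))

  binom-diag : ∀ {i n} → i ≤ n → binom i n ≡ δ n i
  binom-diag {i} {n} i≤n with ℕₚ.m≤n⇒m<n∨m≡n i≤n
  ... | inj₁ i<n  = trans (cong ℕ→ℚ (k>n⇒nCk≡0 i<n)) (sym (δ-≢ (λ n≡i → ℕₚ.<-irrefl (sym n≡i) i<n)))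
  ... | inj₂ refl = trans (cong ℕ→ℚ (nCn≡1 n)) (sym (δ-diag n))

  binom-[1+n]-n : ∀ n → binom (suc n) n ≡ ℕ→ℚ (suc n)
  binom-[1+n]-n n = cong ℕ→ℚ
      (trans (nCk≡nC[n∸k] (ℕₚ.n≤1+n n)) (trans (cong (suc n C_) (ℕₚ.m+n∸n≡m 1 n)) (nC1≡n (suc n))))

  binom-[2+n]-n : ∀ n → binom (suc (suc n)) n ≡ binom (suc (suc n)) 2
  binom-[2+n]-n n = cong ℕ→ℚ (trans (nCk≡nC[n∸k] (ℕₚ.m≤n⇒m≤1+n (ℕₚ.n≤1+n n))) (cong (suc (suc n) C_) (ℕₚ.m+n∸n≡m 2 n)))

  binom-n-2 : ∀ n → binom n 2 ≡ ½ * (ℕ→ℚ n * (ℕ→ℚ n - 1ℚ))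
  binom-n-2 zero    = refl
  binom-n-2 (suc n) = begin
    binom (suc n) 2
        ≡⟨ solve 1 (λ x → x := con ½ :* (con (ℕ→ℚ 2) :* x)) refl (binom (suc n) 2) ⟩
    ½ * (ℕ→ℚ 2 * binom (suc n) 2)
        ≡⟨ cong (½ *_) (binom-absorb n 1) ⟩
    ½ * (ℕ→ℚ (suc n) * binom n 1)
        ≡⟨ cong (λ x → ½ * (ℕ→ℚ (suc n) * ℕ→ℚ x)) (nC1≡n n) ⟩
    ½ * (ℕ→ℚ (suc n) * ℕ→ℚ n)
        ≡⟨ cong (½ *_) (trans (sym (ℕ→ℚ-* (suc n) n)) (ℕ→ℚ[n*[n∸1]] (suc n))) ⟩
    ½ * (ℕ→ℚ (suc n) * (ℕ→ℚ (suc n) - 1ℚ))  ∎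
    where
    open ≡-Reasoning
    open +-*-Solver hiding (⟦_⟧)

  binom-below-diag : ∀ {i n} → i ≤ suc n → binom i n ≡ δ n i + ℕ→ℚ (suc n) * δ (suc n) i
  binom-below-diag {i} {n} i≤1+n with ℕₚ.m≤n⇒m<n∨m≡n i≤1+n
  ... | inj₁ (s≤s i≤n) = begin
    binom i n
        ≡⟨ binom-diag i≤n ⟩
    δ n i
        ≡⟨ solve 2 (λ x c → x := x :+ c :* con 0ℚ) refl (δ n i) (ℕ→ℚ (suc n)) ⟩
    δ n i + ℕ→ℚ (suc n) * 0ℚ
        ≡⟨ cong (λ x → δ n i + ℕ→ℚ (suc n) * x) (sym (δ-≢ (λ 1+n≡i → ℕₚ.<-irrefl (sym 1+n≡i) (s≤s i≤n)))) ⟩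
    δ n i + ℕ→ℚ (suc n) * δ (suc n) i  ∎
    where
    open ≡-Reasoning
    open +-*-Solver hiding (⟦_⟧)
  ... | inj₂ refl = begin
    binom (suc n) n
        ≡⟨ binom-[1+n]-n n ⟩
    ℕ→ℚ (suc n)
        ≡⟨ solve 1 (λ c → c := con 0ℚ :+ c :* con 1ℚ) refl (ℕ→ℚ (suc n)) ⟩
    0ℚ + ℕ→ℚ (suc n) * 1ℚ
        ≡⟨ cong₂ (λ x y → x + ℕ→ℚ (suc n) * y) (sym (δ-≢ {n} {suc n} (ℕₚ.1+n≢n ∘ sym))) (sym (δ-diag (suc n))) ⟩
    δ n (suc n) + ℕ→ℚ (suc n) * δ (suc n) (suc n)  ∎
    where
    open ≡-Reasoning
    open +-*-Solver hiding (⟦_⟧)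

  binom-below-diag₂ : ∀ {i n} → i ≤ suc (suc n) →
    binom i n ≡ δ n i + ℕ→ℚ (suc n) * δ (suc n) i + binom (suc (suc n)) n * δ (suc (suc n)) i
  binom-below-diag₂ {i} {n} i≤2+n with ℕₚ.m≤n⇒m<n∨m≡n i≤2+n
  ... | inj₁ (s≤s i≤1+n) = begin
    binom i n
        ≡⟨ binom-below-diag i≤1+n ⟩
    δ n i + ℕ→ℚ (suc n) * δ (suc n) i
        ≡⟨ solve 2 (λ x c → x := x :+ c :* con 0ℚ) refl _ (binom (suc (suc n)) n) ⟩
    δ n i + ℕ→ℚ (suc n) * δ (suc n) i + binom (suc (suc n)) n * 0ℚ
        ≡⟨ cong (λ x → δ n i + ℕ→ℚ (suc n) * δ (suc n) i + binom (suc (suc n)) n * x)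
            (sym (δ-≢ (λ 2+n≡i → ℕₚ.<-irrefl (sym 2+n≡i) (s≤s i≤1+n)))) ⟩
    δ n i + ℕ→ℚ (suc n) * δ (suc n) i + binom (suc (suc n)) n * δ (suc (suc n)) i  ∎
    where
    open ≡-Reasoning
    open +-*-Solver hiding (⟦_⟧)
  ... | inj₂ refl = begin
    binom (suc (suc n)) n
        ≡⟨ solve 2 (λ c C → C := con 0ℚ :+ c :* con 0ℚ :+ C :* con 1ℚ) refl (ℕ→ℚ (suc n)) (binom (suc (suc n)) n) ⟩
    0ℚ + ℕ→ℚ (suc n) * 0ℚ + binom (suc (suc n)) n * 1ℚ
        ≡⟨ cong₂ (λ x y → x + ℕ→ℚ (suc n) * y + binom (suc (suc n)) n * 1ℚ)
                 (sym (δ-≢ {n} {suc (suc n)} (λ n≡2+n → ℕₚ.<-irrefl n≡2+n (ℕₚ.m<n⇒m<1+n (ℕₚ.n<1+n n)))))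
                     (sym (δ-≢ {suc n} {suc (suc n)} (ℕₚ.1+n≢n ∘ sym))) ⟩
    δ n (suc (suc n)) + ℕ→ℚ (suc n) * δ (suc n) (suc (suc n)) + binom (suc (suc n)) n * 1ℚ
        ≡⟨ cong (λ x → δ n (suc (suc n)) + ℕ→ℚ (suc n) * δ (suc n) (suc (suc n)) + binom (suc (suc n)) n * x)
            (sym (δ-diag (suc (suc n)))) ⟩
    δ n (suc (suc n)) + ℕ→ℚ (suc n) * δ (suc n) (suc (suc n)) + binom (suc (suc n)) n * δ (suc (suc n)) (suc (suc n))  ∎
    where
    open ≡-Reasoning
    open +-*-Solver hiding (⟦_⟧)

  infixl 8 _↓_
  _↓_ : ℕ → ℕ → ℕ
  n ↓ zero  = 1
  n ↓ suc r = n ℕ.* ((n ∸ 1) ↓ r)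

  ∑<-alternating-binom₀ : ∀ {n M} → n ≤ M → ∑< (suc M) (λ j → sgn j * binom n j) ≡ δ 0 n
  ∑<-alternating-binom₀ {zero} {M} _ = begin
    1ℚ + ∑< M (λ j → sgn (suc j) * 0ℚ)
        ≡⟨ cong (1ℚ +_) (trans (∑<-cong M (λ j _ → ℚₚ.*-zeroʳ (sgn (suc j)))) (∑<-zero M)) ⟩
    1ℚ + 0ℚ
        ≡⟨⟩
    1ℚ  ∎
    where open ≡-Reasoning
  ∑<-alternating-binom₀ {suc n} {suc M} (s≤s n≤M) = begin
    t 0 + ∑< (suc M) (λ j → sgn (suc j) * binom (suc n) (suc j))
        ≡⟨ cong (t 0 +_) (∑<-cong (suc M) (λ j _ → trans (cong (sgn (suc j) *_) (binom-pascal n j))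
                                                           (difference (sgn j) (binom n j) (binom n (suc j))))) ⟩
    t 0 + ∑< (suc M) (λ j → t (suc j) - t j)
        ≡⟨ cong (t 0 +_) (∑<-telescope (suc M) t) ⟩
    t 0 + (t (suc M) - t 0)
        ≡⟨ solve 2 (λ a b → a :+ (b :- a) := b) refl (t 0) (t (suc M)) ⟩
    t (suc M)
        ≡⟨ cong (sgn (suc M) *_) (cong ℕ→ℚ (k>n⇒nCk≡0 (s≤s n≤M))) ⟩
    sgn (suc M) * 0ℚ
        ≡⟨ ℚₚ.*-zeroʳ (sgn (suc M)) ⟩
    0ℚ  ∎
    where
    open ≡-Reasoning
    open +-*-Solver hiding (⟦_⟧)
    t : ℕ → ℚ
    t j = sgn j * binom n j
    difference : ∀ s a b → (- s) * (a + b) ≡ (- s) * b - s * a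
    difference = solve 3 (λ s a b → (:- s) :* (a :+ b) := (:- s) :* b :- s :* a) refl

  ∑<-alternating-binom : ∀ r {n M} → n ≤ M →
                         ∑< (suc M) (λ j → sgn j * (ℕ→ℚ (j ↓ r) * binom n j)) ≡ sgn r * (ℕ→ℚ (r !) * δ r n)
  ∑<-alternating-binom zero {n} {M} n≤M = begin
    ∑< (suc M) (λ j → sgn j * (1ℚ * binom n j))
        ≡⟨ ∑<-cong (suc M) (λ j _ → cong (sgn j *_) (ℚₚ.*-identityˡ (binom n j))) ⟩
    ∑< (suc M) (λ j → sgn j * binom n j)
        ≡⟨ ∑<-alternating-binom₀ n≤M ⟩
    δ 0 n
        ≡⟨ sym (ℚₚ.*-identityˡ (δ 0 n)) ⟩
    1ℚ * δ 0 n
        ≡⟨ sym (ℚₚ.*-identityˡ (1ℚ * δ 0 n)) ⟩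
    sgn 0 * (ℕ→ℚ (0 !) * δ 0 n)  ∎
    where open ≡-Reasoning
  ∑<-alternating-binom (suc r) {zero} {M} _ = begin
    0ℚ + ∑< M (λ j → sgn (suc j) * (ℕ→ℚ (suc j ↓ suc r) * 0ℚ))
        ≡⟨ trans (ℚₚ.+-identityˡ _)
            (trans (∑<-cong M (λ j _ → trans (cong (sgn (suc j) *_) (ℚₚ.*-zeroʳ (ℕ→ℚ (suc j ↓ suc r))))
                (ℚₚ.*-zeroʳ (sgn (suc j))))) (∑<-zero M)) ⟩
    0ℚ
        ≡⟨ sym (trans (cong (sgn (suc r) *_) (ℚₚ.*-zeroʳ (ℕ→ℚ (suc r !)))) (ℚₚ.*-zeroʳ (sgn (suc r)))) ⟩
    sgn (suc r) * (ℕ→ℚ (suc r !) * 0ℚ)  ∎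
    where open ≡-Reasoning
  ∑<-alternating-binom (suc r) {suc n} {suc M} (s≤s n≤M) = begin
    0ℚ + ∑< (suc M) (λ j → sgn (suc j) * (ℕ→ℚ (suc j ↓ suc r) * binom (suc n) (suc j)))
        ≡⟨ trans (ℚₚ.+-identityˡ _) (∑<-cong (suc M) (λ j _ → absorbed j)) ⟩
    ∑< (suc M) (λ j → - ℕ→ℚ (suc n) * (sgn j * (ℕ→ℚ (j ↓ r) * binom n j)))
        ≡⟨ sym (*-distribˡ-∑< (suc M) (- ℕ→ℚ (suc n)) (λ j → sgn j * (ℕ→ℚ (j ↓ r) * binom n j))) ⟩
    - ℕ→ℚ (suc n) * ∑< (suc M) (λ j → sgn j * (ℕ→ℚ (j ↓ r) * binom n j))
        ≡⟨ cong (- ℕ→ℚ (suc n) *_) (∑<-alternating-binom r n≤M) ⟩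
    - ℕ→ℚ (suc n) * (sgn r * (ℕ→ℚ (r !) * δ r n))
        ≡⟨ solve 4 (λ a s f d → (:- a) :* (s :* (f :* d)) := (:- s) :* (f :* (a :* d))) refl (ℕ→ℚ (suc n))
            (sgn r) (ℕ→ℚ (r !)) (δ r n) ⟩
    - sgn r * (ℕ→ℚ (r !) * (ℕ→ℚ (suc n) * δ r n))
        ≡⟨ cong (λ x → - sgn r * (ℕ→ℚ (r !) * x)) (*-δ (ℕ→ℚ ∘ suc) r n) ⟩
    - sgn r * (ℕ→ℚ (r !) * (ℕ→ℚ (suc r) * δ r n))
        ≡⟨ cong (- sgn r *_)
            (trans (solve 3 (λ f a d → f :* (a :* d) := (a :* f) :* d) refl (ℕ→ℚ (r !)) (ℕ→ℚ (suc r)) (δ r n))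
                                   (cong (_* δ r n) (sym (ℕ→ℚ-* (suc r) (r !))))) ⟩
    sgn (suc r) * (ℕ→ℚ (suc r !) * δ (suc r) (suc n))  ∎
    where
    open ≡-Reasoning
    open +-*-Solver hiding (⟦_⟧)
    absorbed : ∀ j → sgn (suc j) * (ℕ→ℚ (suc j ↓ suc r) * binom (suc n) (suc j)) ≡
                     - ℕ→ℚ (suc n) * (sgn j * (ℕ→ℚ (j ↓ r) * binom n j))
    absorbed j = begin
      - sgn j * (ℕ→ℚ (suc j ℕ.* (j ↓ r)) * binom (suc n) (suc j))
          ≡⟨ cong (λ x → - sgn j * (x * binom (suc n) (suc j))) (ℕ→ℚ-* (suc j) (j ↓ r)) ⟩
      - sgn j * (ℕ→ℚ (suc j) * ℕ→ℚ (j ↓ r) * binom (suc n) (suc j))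
          ≡⟨ solve 4 (λ s a f c → (:- s) :* (a :* f :* c) := (:- s) :* (f :* (a :* c))) refl (sgn j)
              (ℕ→ℚ (suc j)) (ℕ→ℚ (j ↓ r)) (binom (suc n) (suc j)) ⟩
      - sgn j * (ℕ→ℚ (j ↓ r) * (ℕ→ℚ (suc j) * binom (suc n) (suc j)))
          ≡⟨ cong (λ x → - sgn j * (ℕ→ℚ (j ↓ r) * x)) (binom-absorb n j) ⟩
      - sgn j * (ℕ→ℚ (j ↓ r) * (ℕ→ℚ (suc n) * binom n j))
          ≡⟨ solve 4 (λ s f a c → (:- s) :* (f :* (a :* c)) := (:- a) :* (s :* (f :* c))) refl (sgn j)
              (ℕ→ℚ (j ↓ r)) (ℕ→ℚ (suc n)) (binom n j) ⟩
      - ℕ→ℚ (suc n) * (sgn j * (ℕ→ℚ (j ↓ r) * binom n j))  ∎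

  ℕ→ℚ[j*[N∸j]]-falling : ∀ {N j} → 1 ≤ N → j ≤ N → ℕ→ℚ (j ℕ.* (N ∸ j)) ≡ ℕ→ℚ (N ∸ 1) * ℕ→ℚ (j ↓ 1) - ℕ→ℚ (j ↓ 2)
  ℕ→ℚ[j*[N∸j]]-falling {N} {j} 1≤N j≤N = begin
    ℕ→ℚ (j ℕ.* (N ∸ j))
        ≡⟨ ℕ→ℚ[j*[N∸j]] j≤N ⟩
    ℕ→ℚ j * (ℕ→ℚ N - ℕ→ℚ j)
        ≡⟨ solve 2 (λ n x → x :* (n :- x) := (n :- con 1ℚ) :* x :- x :* (x :- con 1ℚ)) refl (ℕ→ℚ N) (ℕ→ℚ j) ⟩
    (ℕ→ℚ N - 1ℚ) * ℕ→ℚ j - ℕ→ℚ j * (ℕ→ℚ j - 1ℚ)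
        ≡⟨ cong₃ (sym (ℕ→ℚ-∸ 1≤N)) (cong ℕ→ℚ (sym (ℕₚ.*-identityʳ j))) (sym (ℕ→ℚ[n*[n∸1]] j)) ⟩
    ℕ→ℚ (N ∸ 1) * ℕ→ℚ (j ↓ 1) - ℕ→ℚ (j ℕ.* (j ∸ 1))
        ≡⟨ cong (λ x → ℕ→ℚ (N ∸ 1) * ℕ→ℚ (j ↓ 1) - ℕ→ℚ (j ℕ.* x)) (sym (ℕₚ.*-identityʳ (j ∸ 1))) ⟩
    ℕ→ℚ (N ∸ 1) * ℕ→ℚ (j ↓ 1) - ℕ→ℚ (j ↓ 2)  ∎
    where
    open ≡-Reasoning
    open +-*-Solver hiding (⟦_⟧)
    cong₃ : ∀ {x x′ y y′ z z′} → x ≡ x′ → y ≡ y′ → z ≡ z′ → x * y - z ≡ x′ * y′ - z′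
    cong₃ refl refl refl = refl

  ℕ→ℚ[j*[N∸j]]-reflect : ∀ {N j} → j ≤ N → ℕ→ℚ ((N ∸ j) ℕ.* (N ∸ (N ∸ j))) ≡ ℕ→ℚ (j ℕ.* (N ∸ j))
  ℕ→ℚ[j*[N∸j]]-reflect {N} {j} j≤N = cong ℕ→ℚ (trans (cong ((N ∸ j) ℕ.*_) (ℕₚ.m∸[m∸n]≡n j≤N)) (ℕₚ.*-comm (N ∸ j) j))

  6*∑<-j*[x-j] : ∀ n x → ℕ→ℚ 6 * ∑< n (λ j → ℕ→ℚ j * (x - ℕ→ℚ j)) ≡
                        ℕ→ℚ 3 * x * ℕ→ℚ n * (ℕ→ℚ n - 1ℚ) - (ℕ→ℚ n - 1ℚ) * ℕ→ℚ n * (ℕ→ℚ 2 * ℕ→ℚ n - 1ℚ)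
  6*∑<-j*[x-j] zero    x = solve 1
      (λ x → con (ℕ→ℚ 6) :* con 0ℚ := con (ℕ→ℚ 3) :* x :* con 0ℚ :* (con 0ℚ :- con 1ℚ) :- (con 0ℚ :- con 1ℚ)
          :* con 0ℚ :* (con (ℕ→ℚ 2) :* con 0ℚ :- con 1ℚ)) refl x
    where open +-*-Solver hiding (⟦_⟧)
  6*∑<-j*[x-j] (suc n) x = begin
    ℕ→ℚ 6 * ∑< (suc n) (λ j → ℕ→ℚ j * (x - ℕ→ℚ j))
        ≡⟨ cong (ℕ→ℚ 6 *_) (∑<-last n (λ j → ℕ→ℚ j * (x - ℕ→ℚ j))) ⟩
    ℕ→ℚ 6 * (∑< n (λ j → ℕ→ℚ j * (x - ℕ→ℚ j)) + ℕ→ℚ n * (x - ℕ→ℚ n))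
        ≡⟨ ℚₚ.*-distribˡ-+ (ℕ→ℚ 6) (∑< n (λ j → ℕ→ℚ j * (x - ℕ→ℚ j))) (ℕ→ℚ n * (x - ℕ→ℚ n)) ⟩
    ℕ→ℚ 6 * ∑< n (λ j → ℕ→ℚ j * (x - ℕ→ℚ j)) + ℕ→ℚ 6 * (ℕ→ℚ n * (x - ℕ→ℚ n))
        ≡⟨ cong (_+ ℕ→ℚ 6 * (ℕ→ℚ n * (x - ℕ→ℚ n))) (6*∑<-j*[x-j] n x) ⟩
    ℕ→ℚ 3 * x * ℕ→ℚ n * (ℕ→ℚ n - 1ℚ) - (ℕ→ℚ n - 1ℚ) * ℕ→ℚ n * (ℕ→ℚ 2 * ℕ→ℚ n - 1ℚ) + ℕ→ℚ 6 * (ℕ→ℚ n * (x - ℕ→ℚ n))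
        ≡⟨ solve 2 (λ x n → con (ℕ→ℚ 3) :* x :* n :* (n :- con 1ℚ) :- (n :- con 1ℚ) :* n :*
            (con (ℕ→ℚ 2) :* n :- con 1ℚ) :+ con (ℕ→ℚ 6) :* (n :* (x :- n))
                          := con (ℕ→ℚ 3) :* x :* (con 1ℚ :+ n) :* ((con 1ℚ :+ n) :- con 1ℚ) :-
                              ((con 1ℚ :+ n) :- con 1ℚ) :* (con 1ℚ :+ n) :*
                                  (con (ℕ→ℚ 2) :* (con 1ℚ :+ n) :- con 1ℚ)) refl x (ℕ→ℚ n) ⟩
    ℕ→ℚ 3 * x * (1ℚ + ℕ→ℚ n) * ((1ℚ + ℕ→ℚ n) - 1ℚ) - ((1ℚ + ℕ→ℚ n) - 1ℚ) * (1ℚ + ℕ→ℚ n) * (ℕ→ℚ 2 * (1ℚ + ℕ→ℚ n) - 1ℚ)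
        ≡⟨ cong (λ m → ℕ→ℚ 3 * x * m * (m - 1ℚ) - (m - 1ℚ) * m * (ℕ→ℚ 2 * m - 1ℚ)) (sym (ℕ→ℚ-+ 1 n)) ⟩
    ℕ→ℚ 3 * x * ℕ→ℚ (suc n) * (ℕ→ℚ (suc n) - 1ℚ) - (ℕ→ℚ (suc n) - 1ℚ) * ℕ→ℚ (suc n) * (ℕ→ℚ 2 * ℕ→ℚ (suc n) - 1ℚ)  ∎
    where
    open ≡-Reasoning
    open +-*-Solver hiding (⟦_⟧)

  -- The relations with d₁ = d₂ = 0

  coeff-harmonicSide : ∀ k₁ k₂ s → coeff (harmonicSide k₁ k₂ 0 0) s ≡
    coeff ⟦ G² k₁ k₂ 0 0 ⟧ s + coeff ⟦ G² k₂ k₁ 0 0 ⟧ s + coeff ⟦ G¹ (k₁ ℕ.+ k₂) 0 ⟧ s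
  coeff-harmonicSide k₁ k₂ s = trans (coeff-++ (⟦ G² k₁ k₂ 0 0 ⟧ ⊕ ⟦ G² k₂ k₁ 0 0 ⟧) ⟦ G¹ (k₁ ℕ.+ k₂) 0 ⟧ s)
    (cong (_+ coeff ⟦ G¹ (k₁ ℕ.+ k₂) 0 ⟧ s) (coeff-++ ⟦ G² k₁ k₂ 0 0 ⟧ ⟦ G² k₂ k₁ 0 0 ⟧ s))

  coeff-shuffleSide : ∀ k₁ k₂ s → coeff (shuffleSide k₁ k₂ 0 0) s ≡
    ∑< (k₁ ℕ.+ k₂ ∸ 1) (λ i → (binom i (k₁ ∸ 1) + binom i (k₂ ∸ 1)) * coeff ⟦ G² (suc i) (k₁ ℕ.+ k₂ ∸ suc i) 0 0 ⟧ s)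
    + binom (k₁ ℕ.+ k₂ ∸ 2) (k₁ ∸ 1) * coeff ⟦ G¹ (k₁ ℕ.+ k₂ ∸ 1) 1 ⟧ s
  coeff-shuffleSide k₁ k₂ s = trans (coeff-++ (Σ[ range 1 (K ∸ 1) ] column) _ s)
    (cong₂ _+_ (trans (coeff-Σ-range 1 (K ∸ 1) column s) (∑<-cong (K ∸ 1) (λ i _ → coeff-column i)))
               (trans (coeff-· (factRatio 0 0 * binom (K ∸ 2) (k₁ ∸ 1)) ⟦ G¹ (K ∸ 1) 1 ⟧ s)
                   (cong (_* coeff ⟦ G¹ (K ∸ 1) 1 ⟧ s) (ℚₚ.*-identityˡ (binom (K ∸ 2) (k₁ ∸ 1))))))
    where
    K = k₁ ℕ.+ k₂
    column : ℕ → FSum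
    column l₁ = Σ[ range 0 0 ] λ e₁ →
      ( ℕ→ℚ (((l₁ ∸ 1) C (k₁ ∸ 1)) ℕ.* (0 C e₁)) * sgn (0 ∸ e₁)
      + ℕ→ℚ (((l₁ ∸ 1) C (k₂ ∸ 1)) ℕ.* (0 C e₁)) * sgn (0 ∸ e₁))
      · ⟦ G² l₁ (K ∸ l₁) e₁ (0 ∸ e₁) ⟧
    binom*1 : ∀ n k → ℕ→ℚ ((n C k) ℕ.* 1) * 1ℚ ≡ binom n k
    binom*1 n k = trans (ℚₚ.*-identityʳ _) (cong ℕ→ℚ (ℕₚ.*-identityʳ (n C k)))
    coeff-column : ∀ i → coeff (column (suc i)) s ≡ (binom i (k₁ ∸ 1) + binom i (k₂ ∸ 1)) * coeff
        ⟦ G² (suc i) (K ∸ suc i) 0 0 ⟧ s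
    coeff-column i = trans
        (coeff-· (ℕ→ℚ ((i C (k₁ ∸ 1)) ℕ.* 1) * 1ℚ + ℕ→ℚ ((i C (k₂ ∸ 1)) ℕ.* 1) * 1ℚ) ⟦ G² (suc i) (K ∸ suc i) 0 0 ⟧ s)
      (cong (_* coeff ⟦ G² (suc i) (K ∸ suc i) 0 0 ⟧ s) (cong₂ _+_ (binom*1 i (k₁ ∸ 1)) (binom*1 i (k₂ ∸ 1))))

  -- The relation combination in _≈[_]_ is a pattern lambda that cannot be named here, so lemmas
  -- about it take any function that agrees with it.
  ScalesRelations : ∀ K → (ℚ × RelIx K → FSum) → Set
  ScalesRelations K F = ∀ c r → F (c , r) ≡ c · relVec r

  -- The index j ∈ [0, N] stands for (k₁, k₂) = (j + 1, N + 1 − j), so all relations have weight N + 2.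
  module ZeroLowerIndices (N : ℕ) where

    1+N∸j≡1+[N∸j] : ∀ {j} → j ≤ N → suc N ∸ j ≡ suc (N ∸ j)
    1+N∸j≡1+[N∸j] j≤N = ℕₚ.+-∸-assoc 1 j≤N

    1+j+[1+N∸j]≡2+N : ∀ {j} → j ≤ N → suc j ℕ.+ (suc N ∸ j) ≡ suc (suc N)
    1+j+[1+N∸j]≡2+N {j} j≤N = cong suc (ℕₚ.m+[n∸m]≡n (ℕₚ.m≤n⇒m≤1+n j≤N))

    1+j+[1+N∸j]+0+0≡2+N : ∀ {j} → j ≤ N → suc j ℕ.+ (suc N ∸ j) ℕ.+ 0 ℕ.+ 0 ≡ suc (suc N)
    1+j+[1+N∸j]+0+0≡2+N {j} j≤N = trans (ℕₚ.+-identityʳ _) (trans (ℕₚ.+-identityʳ _) (1+j+[1+N∸j]≡2+N j≤N))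

    1≤1+N∸j : ∀ {j} → j ≤ N → 1 ≤ suc N ∸ j
    1≤1+N∸j j≤N = subst (1 ≤_) (sym (1+N∸j≡1+[N∸j] j≤N)) (s≤s z≤n)

    relation₁ relation₂ : ∀ {j} → j ≤ N → RelIx (suc (suc N))
    relation₁ {j} j≤N = rel₁ (suc j) (suc N ∸ j) 0 0 (s≤s z≤n) (1≤1+N∸j j≤N) (1+j+[1+N∸j]+0+0≡2+N j≤N)
    relation₂ {j} j≤N = rel₂ (suc j) (suc N ∸ j) 0 0 (s≤s z≤n) (1≤1+N∸j j≤N) (1+j+[1+N∸j]+0+0≡2+N j≤N)

    weighted : (ℕ → ℚ) → (∀ {j} → j ≤ N → RelIx (suc (suc N))) → List (ℚ × RelIx (suc (suc N)))
    weighted c rel = tabulate {n = suc N} (λ j → c (toℕ j) , rel (toℕ≤pred[n] j))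

    combination : (a b : ℕ → ℚ) → List (ℚ × RelIx (suc (suc N)))
    combination a b = weighted a relation₁ ++ weighted b relation₂

    -- The second relation at j equals the one at N − j, so only symmetric weights matter.  For them the
    -- combination contains G(i + 1, N + 1 − i) with coefficient 2 (b i − a i − Σⱼ b j C(i, j)).
    record BalancedWeights : Set where
      field
        a b         : ℕ → ℚ
        a-symmetric : ∀ {j} → j ≤ N → a (N ∸ j) ≡ a j
        b-symmetric : ∀ {j} → j ≤ N → b (N ∸ j) ≡ b j
        balanced    : ∀ {i} → i ≤ N → ∑< (suc N) (λ j → b j * binom i j) ≡ b i - a i

    module CoefficientsAt (s : Sym) where

      p g : ℕ → ℚ
      p j = coeff ⟦ Pˢ (suc j) (suc N ∸ j) 0 0 ⟧ s
      g j = coeff ⟦ G² (suc j) (suc N ∸ j) 0 0 ⟧ s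

      z d : ℚ
      z = coeff ⟦ G¹ (suc (suc N)) 0 ⟧ s
      d = coeff ⟦ G¹ (suc N) 1 ⟧ s

      h σ : ℕ → ℚ
      h j = g j + g (N ∸ j) + z
      σ j = ∑< (suc N) (λ i → (binom i j + binom i (N ∸ j)) * g i) + binom N j * d

      coeff-harmonic : ∀ {j} → j ≤ N → coeff (harmonicSide (suc j) (suc N ∸ j) 0 0) s ≡ h j
      coeff-harmonic {j} j≤N = trans (coeff-harmonicSide (suc j) (suc N ∸ j) s)
        (cong₂ (λ t u → g j + coeff ⟦ t ⟧ s + coeff ⟦ G¹ u 0 ⟧ s) mirrored (1+j+[1+N∸j]≡2+N j≤N))
        where
        mirrored : G² (suc N ∸ j) (suc j) 0 0 ≡ G² (suc (N ∸ j)) (suc N ∸ (N ∸ j)) 0 0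
        mirrored = cong₂ (λ k₁ k₂ → G² k₁ k₂ 0 0) (1+N∸j≡1+[N∸j] j≤N)
          (sym (trans (1+N∸j≡1+[N∸j] (ℕₚ.m∸n≤m N j)) (cong suc (ℕₚ.m∸[m∸n]≡n j≤N))))

      coeff-shuffle : ∀ {j} → j ≤ N → coeff (shuffleSide (suc j) (suc N ∸ j) 0 0) s ≡ σ j
      coeff-shuffle {j} j≤N = trans (coeff-shuffleSide (suc j) (suc N ∸ j) s)
        (cong₂ (λ K n → ∑< (K ∸ 1) (λ i → (binom i j + binom i n) * coeff ⟦ G² (suc i) (K ∸ suc i) 0 0 ⟧ s)
                         + binom (K ∸ 2) j * coeff ⟦ G¹ (K ∸ 1) 1 ⟧ s)
               (1+j+[1+N∸j]≡2+N j≤N) (cong (_∸ 1) (1+N∸j≡1+[N∸j] j≤N)))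

      coeff-combination : ∀ a b (F : ℚ × RelIx (suc (suc N)) → FSum) → ScalesRelations _ F →
        coeff (Σ[ combination a b ] F) s ≡ ∑< (suc N) (λ j → a j * (p j - h j)) + ∑< (suc N) (λ j → b j * (h j - σ j))
      coeff-combination a b F F-scales = trans
          (cong (λ xs → coeff xs s) (concatMap-++ F (weighted a relation₁) (weighted b relation₂)))
        (trans (coeff-++ (Σ[ weighted a relation₁ ] F) _ s)
            (cong₂ _+_ (coeff-weighted a relation₁ (λ j → p j - h j) coeff-relation₁)
                   (coeff-weighted b relation₂ (λ j → h j - σ j) coeff-relation₂)))
        where
        coeff-relation₁ : ∀ {j} (j≤N : j ≤ N) → coeff (relVec (relation₁ j≤N)) s ≡ p j - h j
        coeff-relation₁ {j} j≤N = trans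
            (coeff-⊖ ⟦ Pˢ (suc j) (suc N ∸ j) 0 0 ⟧ (harmonicSide (suc j) (suc N ∸ j) 0 0) s)
                (cong (λ x → p j - x) (coeff-harmonic j≤N))
        coeff-relation₂ : ∀ {j} (j≤N : j ≤ N) → coeff (relVec (relation₂ j≤N)) s ≡ h j - σ j
        coeff-relation₂ {j} j≤N = trans
            (coeff-⊖ (harmonicSide (suc j) (suc N ∸ j) 0 0) (shuffleSide (suc j) (suc N ∸ j) 0 0) s)
                (cong₂ _-_ (coeff-harmonic j≤N) (coeff-shuffle j≤N))
        coeff-weighted : ∀ (c : ℕ → ℚ) (rel : ∀ {j} → j ≤ N → RelIx (suc (suc N))) (v : ℕ → ℚ) →
                         (∀ {j} (j≤N : j ≤ N) → coeff (relVec (rel j≤N)) s ≡ v j) →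
                         coeff (Σ[ weighted c rel ] F) s ≡ ∑< (suc N) (λ j → c j * v j)
        coeff-weighted c rel v coeff-rel = begin
          coeff (Σ[ weighted c rel ] F) s
              ≡⟨ coeff-Σ-tabulate (suc N) (λ j → c (toℕ j) , rel (toℕ≤pred[n] j)) F s ⟩
          sum {suc N} (λ j → coeff (F (c (toℕ j) , rel (toℕ≤pred[n] j))) s)
              ≡⟨ sum-cong-≗ {suc N} (λ j → trans (cong (λ xs → coeff xs s) (F-scales (c (toℕ j)) (rel (toℕ≤pred[n] j))))
                                           (trans (coeff-· (c (toℕ j)) (relVec (rel (toℕ≤pred[n] j))) s)
                                               (cong (c (toℕ j) *_) (coeff-rel (toℕ≤pred[n] j))))) ⟩
          sum {suc N} (λ j → c (toℕ j) * v (toℕ j))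
              ≡⟨ sym (∑<≡sum (suc N) (λ j → c j * v j)) ⟩
          ∑< (suc N) (λ j → c j * v j)  ∎
          where open ≡-Reasoning

      module _ (w : BalancedWeights) where
        open BalancedWeights w

        private
          e : ℕ → ℚ
          e j = b j - a j

          e-symmetric : ∀ {j} → j ≤ N → e (N ∸ j) ≡ e j
          e-symmetric j≤N = cong₂ _-_ (b-symmetric j≤N) (a-symmetric j≤N)

        ∑<-excess*harmonic : ∑< (suc N) (λ j → e j * h j) ≡
                             ∑< (suc N) (λ j → e j * g j) + ∑< (suc N) (λ j → e j * g j) + ∑< (suc N) e * z
        ∑<-excess*harmonic = begin
          ∑< (suc N) (λ j → e j * h j)
              ≡⟨ ∑<-cong (suc N) (λ j _ → ℚₚ.*-distribˡ-+ (e j) (g j + g (N ∸ j)) z) ⟩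
          ∑< (suc N) (λ j → e j * (g j + g (N ∸ j)) + e j * z)
              ≡⟨ ∑<-distrib-+ (suc N) (λ j → e j * (g j + g (N ∸ j))) (λ j → e j * z) ⟩
          ∑< (suc N) (λ j → e j * (g j + g (N ∸ j))) + ∑< (suc N) (λ j → e j * z)
              ≡⟨ cong₂ _+_ (trans (∑<-cong (suc N) (λ j _ → ℚₚ.*-distribˡ-+ (e j) (g j) (g (N ∸ j))))
                  (∑<-distrib-+ (suc N) (λ j → e j * g j) (λ j → e j * g (N ∸ j))))
                           (sym (*-distribʳ-∑< (suc N) z e)) ⟩
          ∑< (suc N) (λ j → e j * g j) + ∑< (suc N) (λ j → e j * g (N ∸ j)) + ∑< (suc N) e * z
              ≡⟨ cong (λ x → ∑< (suc N) (λ j → e j * g j) + x + ∑< (suc N) e * z) (∑<-mirror N g e-symmetric) ⟩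
          ∑< (suc N) (λ j → e j * g j) + ∑< (suc N) (λ j → e j * g j) + ∑< (suc N) e * z  ∎
          where open ≡-Reasoning

        ∑<-weights*twoSidedBinom : ∀ {i} → i ≤ N → ∑< (suc N) (λ j → b j * (binom i j + binom i (N ∸ j))) ≡ e i + e i
        ∑<-weights*twoSidedBinom {i} i≤N = begin
          ∑< (suc N) (λ j → b j * (binom i j + binom i (N ∸ j)))
              ≡⟨ ∑<-cong (suc N) (λ j _ → ℚₚ.*-distribˡ-+ (b j) (binom i j) (binom i (N ∸ j))) ⟩
          ∑< (suc N) (λ j → b j * binom i j + b j * binom i (N ∸ j))
              ≡⟨ ∑<-distrib-+ (suc N) (λ j → b j * binom i j) (λ j → b j * binom i (N ∸ j)) ⟩
          ∑< (suc N) (λ j → b j * binom i j) + ∑< (suc N) (λ j → b j * binom i (N ∸ j))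
              ≡⟨ cong (∑< (suc N) (λ j → b j * binom i j) +_) (∑<-mirror N (binom i) b-symmetric) ⟩
          ∑< (suc N) (λ j → b j * binom i j) + ∑< (suc N) (λ j → b j * binom i j)
              ≡⟨ cong₂ _+_ (balanced i≤N) (balanced i≤N) ⟩
          e i + e i  ∎
          where open ≡-Reasoning

        ∑<-weights*shuffle : ∑< (suc N) (λ j → b j * σ j) ≡
                             ∑< (suc N) (λ j → e j * g j) + ∑< (suc N) (λ j → e j * g j) + e N * d
        ∑<-weights*shuffle = begin
          ∑< (suc N) (λ j → b j * σ j)
              ≡⟨ ∑<-cong (suc N) (λ j _ → trans (ℚₚ.*-distribˡ-+ (b j) _ (binom N j * d))
                   (cong₂ _+_ (*-distribˡ-∑< (suc N) (b j) (λ i → (binom i j + binom i (N ∸ j)) * g i))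
                              (sym (ℚₚ.*-assoc (b j) (binom N j) d)))) ⟩
          ∑< (suc N) (λ j → ∑< (suc N) (λ i → b j * ((binom i j + binom i (N ∸ j)) * g i)) + b j * binom N j * d)
              ≡⟨ ∑<-distrib-+ (suc N) (λ j → ∑< (suc N) (λ i → b j * ((binom i j + binom i (N ∸ j)) * g i)))
                  (λ j → b j * binom N j * d) ⟩
          ∑< (suc N) (λ j → ∑< (suc N) (λ i → b j * ((binom i j + binom i (N ∸ j)) * g i))) + ∑< (suc N)
              (λ j → b j * binom N j * d)
              ≡⟨ cong₂ _+_ (∑<-comm (suc N) (suc N) (λ j i → b j * ((binom i j + binom i (N ∸ j)) * g i)))
                           (sym (*-distribʳ-∑< (suc N) d (λ j → b j * binom N j))) ⟩
          ∑< (suc N) (λ i → ∑< (suc N) (λ j → b j * ((binom i j + binom i (N ∸ j)) * g i))) + ∑< (suc N)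
              (λ j → b j * binom N j) * d
              ≡⟨ cong₂ _+_ (∑<-cong (suc N) (λ i i≤N → collect i (ℕₚ.≤-pred i≤N))) (cong (_* d) (balanced ℕₚ.≤-refl)) ⟩
          ∑< (suc N) (λ i → e i * g i + e i * g i) + e N * d
              ≡⟨ cong (_+ e N * d) (∑<-distrib-+ (suc N) (λ i → e i * g i) (λ i → e i * g i)) ⟩
          ∑< (suc N) (λ j → e j * g j) + ∑< (suc N) (λ j → e j * g j) + e N * d  ∎
          where
          open ≡-Reasoning
          collect : ∀ i → i ≤ N → ∑< (suc N) (λ j → b j * ((binom i j + binom i (N ∸ j)) * g i)) ≡ e i * g i + e i * g i
          collect i i≤N = begin
            ∑< (suc N) (λ j → b j * ((binom i j + binom i (N ∸ j)) * g i))
                ≡⟨ ∑<-cong (suc N) (λ j _ → sym (ℚₚ.*-assoc (b j) (binom i j + binom i (N ∸ j)) (g i))) ⟩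
            ∑< (suc N) (λ j → b j * (binom i j + binom i (N ∸ j)) * g i)
                ≡⟨ sym (*-distribʳ-∑< (suc N) (g i) (λ j → b j * (binom i j + binom i (N ∸ j)))) ⟩
            ∑< (suc N) (λ j → b j * (binom i j + binom i (N ∸ j))) * g i
                ≡⟨ cong (_* g i) (∑<-weights*twoSidedBinom i≤N) ⟩
            (e i + e i) * g i
                ≡⟨ ℚₚ.*-distribʳ-+ (g i) (e i) (e i) ⟩
            e i * g i + e i * g i  ∎

        coeff-balanced-combination : ∀ (F : ℚ × RelIx (suc (suc N)) → FSum) → ScalesRelations _ F →
          coeff (Σ[ combination a b ] F) s ≡ ∑< (suc N) (λ j → a j * p j) + ∑< (suc N) e * z - e N * d
        coeff-balanced-combination F F-scales = begin
          coeff (Σ[ combination a b ] F) s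
              ≡⟨ coeff-combination a b F F-scales ⟩
          ∑< (suc N) (λ j → a j * (p j - h j)) + ∑< (suc N) (λ j → b j * (h j - σ j))
              ≡⟨ sym (∑<-distrib-+ (suc N) (λ j → a j * (p j - h j)) (λ j → b j * (h j - σ j))) ⟩
          ∑< (suc N) (λ j → a j * (p j - h j) + b j * (h j - σ j))
              ≡⟨ ∑<-cong (suc N) (λ j _ → regroup (a j) (b j) (p j) (h j) (σ j)) ⟩
          ∑< (suc N) (λ j → a j * p j + e j * h j - b j * σ j)
              ≡⟨ trans (∑<-distrib-- (suc N) (λ j → a j * p j + e j * h j) (λ j → b j * σ j))
                       (cong (_- ∑< (suc N) (λ j → b j * σ j))
                           (∑<-distrib-+ (suc N) (λ j → a j * p j) (λ j → e j * h j))) ⟩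
          ∑< (suc N) (λ j → a j * p j) + ∑< (suc N) (λ j → e j * h j) - ∑< (suc N) (λ j → b j * σ j)
              ≡⟨ cong₂ (λ x y → ∑< (suc N) (λ j → a j * p j) + x - y) ∑<-excess*harmonic ∑<-weights*shuffle ⟩
          ∑< (suc N) (λ j → a j * p j) + (X + X + ∑< (suc N) e * z) - (X + X + e N * d)
              ≡⟨ cancel (∑< (suc N) (λ j → a j * p j)) X (∑< (suc N) e * z) (e N * d) ⟩
          ∑< (suc N) (λ j → a j * p j) + ∑< (suc N) e * z - e N * d  ∎
          where
          open ≡-Reasoning
          open +-*-Solver hiding (⟦_⟧)
          X = ∑< (suc N) (λ j → e j * g j)
          regroup : ∀ a b p h σ → a * (p - h) + b * (h - σ) ≡ a * p + (b - a) * h - b * σ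
          regroup = solve 5 (λ a b p h σ → a :* (p :- h) :+ b :* (h :- σ) := a :* p :+ (b :- a) :* h :- b :* σ) refl
          cancel : ∀ A X E D → A + (X + X + E) - (X + X + D) ≡ A + E - D
          cancel = solve 4 (λ A X E D → A :+ (X :+ X :+ E) :- (X :+ X :+ D) := A :+ E :- D) refl

  -- The first identity

  IdentityI : ℕ → Set
  IdentityI k = ⟦ G¹ (k ∸ 1) 1 ⟧ ≈[ k ]
    ((ℤ.+ (suc k) / 2) · ⟦ G¹ k 0 ⟧) ⊖ (Σ[ evensIn 2 (k ∸ 2) ] λ k₁ → ⟦ Pˢ k₁ (k ∸ k₁) 0 0 ⟧)

  module FirstIdentity {N : ℕ} (2∣N : 2 ∣ N) (1≤N : 1 ≤ N) where
    open ZeroLowerIndices N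

    c : ℚ
    c = ℤ.+ suc (suc (suc N)) / 2

    P : ℕ → FSum
    P k₁ = ⟦ Pˢ k₁ (suc (suc N) ∸ k₁) 0 0 ⟧

    a b : ℕ → ℚ
    a j = evenWindow 2 N (suc j)
    b j = - ½ * (sgn j + (δ 0 j + δ N j))

    a-closed : ∀ {j} → j ≤ N → a j ≡ ½ * (1ℚ - sgn j)
    a-closed {zero}  _      = refl
    a-closed {suc j} 1+j≤N with suc (suc j) ℕ.≤? N
    ... | yes 2+j≤N = begin
      𝟙 (does (suc (suc j) ℕ.≤? N)) * 𝟙 (does (2 ∣? suc (suc j)))
          ≡⟨ cong (λ w → 𝟙 w * 𝟙 (does (2 ∣? suc (suc j)))) (dec-true (suc (suc j) ℕ.≤? N) 2+j≤N) ⟩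
      1ℚ * 𝟙 (does (2 ∣? suc (suc j)))
          ≡⟨ ℚₚ.*-identityˡ (𝟙 (does (2 ∣? suc (suc j)))) ⟩
      𝟙 (does (2 ∣? suc (suc j)))
          ≡⟨ 𝟙[2∣1+j]≡½[1-sgn[j]] (suc j) ⟩
      ½ * (1ℚ - sgn (suc j))  ∎
      where open ≡-Reasoning
    ... | no 2+j≰N with ℕₚ.m≤n⇒m<n∨m≡n 1+j≤N
    ...   | inj₁ 2+j≤N  = contradiction 2+j≤N 2+j≰N
    ...   | inj₂ 1+j≡N = begin
      𝟙 (does (suc (suc j) ℕ.≤? N)) * 𝟙 (does (2 ∣? suc (suc j)))
          ≡⟨ cong (λ w → 𝟙 w * 𝟙 (does (2 ∣? suc (suc j)))) (dec-false (suc (suc j) ℕ.≤? N) 2+j≰N) ⟩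
      0ℚ * 𝟙 (does (2 ∣? suc (suc j)))
          ≡⟨ ℚₚ.*-zeroˡ (𝟙 (does (2 ∣? suc (suc j)))) ⟩
      ½ * (1ℚ - 1ℚ)
          ≡⟨ cong (λ x → ½ * (1ℚ - x)) (sym (trans (cong sgn 1+j≡N) (sgn-even 2∣N))) ⟩
      ½ * (1ℚ - sgn (suc j))  ∎
      where open ≡-Reasoning

    a-symmetric : ∀ {j} → j ≤ N → a (N ∸ j) ≡ a j
    a-symmetric {j} j≤N = begin
      a (N ∸ j)                ≡⟨ a-closed (ℕₚ.m∸n≤m N j) ⟩
      ½ * (1ℚ - sgn (N ∸ j))   ≡⟨ cong (λ x → ½ * (1ℚ - x)) (sgn-reflect 2∣N j≤N) ⟩
      ½ * (1ℚ - sgn j)         ≡⟨ sym (a-closed j≤N) ⟩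
      a j                      ∎
      where open ≡-Reasoning

    b-symmetric : ∀ {j} → j ≤ N → b (N ∸ j) ≡ b j
    b-symmetric {j} j≤N = cong (λ x → - ½ * x) (cong₂ _+_ (sgn-reflect 2∣N j≤N) (δ-pair-reflect z≤n j≤N))

    balanced : ∀ {i} → i ≤ N → ∑< (suc N) (λ j → b j * binom i j) ≡ b i - a i
    balanced {i} i≤N = begin
      ∑< (suc N) (λ j → b j * binom i j)
          ≡⟨ ∑<-cong (suc N) (λ j _ → expand (sgn j) (δ 0 j + δ N j) (binom i j)) ⟩
      ∑< (suc N) (λ j → - ½ * (sgn j * binom i j + (δ 0 j + δ N j) * binom i j))
          ≡⟨ sym (*-distribˡ-∑< (suc N) (- ½) (λ j → sgn j * binom i j + (δ 0 j + δ N j) * binom i j)) ⟩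
      - ½ * ∑< (suc N) (λ j → sgn j * binom i j + (δ 0 j + δ N j) * binom i j)
          ≡⟨ cong (- ½ *_) (∑<-distrib-+ (suc N) (λ j → sgn j * binom i j) (λ j → (δ 0 j + δ N j) * binom i j)) ⟩
      - ½ * (∑< (suc N) (λ j → sgn j * binom i j) + ∑< (suc N) (λ j → (δ 0 j + δ N j) * binom i j))
          ≡⟨ cong (λ x → - ½ * x) (cong₂ _+_ (∑<-alternating-binom₀ i≤N) (∑<-δ₂ (binom i) (s≤s z≤n) (ℕₚ.n<1+n N))) ⟩
      - ½ * (δ 0 i + (1ℚ + binom i N))
          ≡⟨ cong (λ x → - ½ * (δ 0 i + (1ℚ + x))) (binom-diag i≤N) ⟩
      - ½ * (δ 0 i + (1ℚ + δ N i))
          ≡⟨ solve 3 (λ s d₀ d → :- con ½ :* (d₀ :+ (con 1ℚ :+ d)) := :- con ½ :* (s :+ (d₀ :+ d)) :- con ½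
              :* (con 1ℚ :- s)) refl (sgn i) (δ 0 i) (δ N i) ⟩
      b i - ½ * (1ℚ - sgn i)
          ≡⟨ cong (λ x → b i - x) (sym (a-closed i≤N)) ⟩
      b i - a i  ∎
      where
      open ≡-Reasoning
      open +-*-Solver hiding (⟦_⟧)
      expand : ∀ s D c → - ½ * (s + D) * c ≡ - ½ * (s * c + D * c)
      expand = solve 3 (λ s D c → :- con ½ :* (s :+ D) :* c := :- con ½ :* (s :* c :+ D :* c)) refl

    weights : BalancedWeights
    weights = record { a = a ; b = b ; a-symmetric = a-symmetric ; b-symmetric = b-symmetric ; balanced = balanced }

    ∑<-excess : ∑< (suc N) (λ j → b j - a j) ≡ - c
    ∑<-excess = begin
      ∑< (suc N) (λ j → b j - a j)
          ≡⟨ ∑<-cong (suc N) (λ j j<1+N → cong (λ x → b j - x) (a-closed (ℕₚ.≤-pred j<1+N))) ⟩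
      ∑< (suc N) (λ j → b j - ½ * (1ℚ - sgn j))
          ≡⟨ ∑<-cong (suc N) (λ j _ → excess (sgn j) (δ 0 j + δ N j)) ⟩
      ∑< (suc N) (λ j → - ½ * (1ℚ + (δ 0 j + δ N j) * 1ℚ))
          ≡⟨ sym (*-distribˡ-∑< (suc N) (- ½) (λ j → 1ℚ + (δ 0 j + δ N j) * 1ℚ)) ⟩
      - ½ * ∑< (suc N) (λ j → 1ℚ + (δ 0 j + δ N j) * 1ℚ)
          ≡⟨ cong (- ½ *_) (∑<-distrib-+ (suc N) (λ _ → 1ℚ) (λ j → (δ 0 j + δ N j) * 1ℚ)) ⟩
      - ½ * (∑< (suc N) (λ _ → 1ℚ) + ∑< (suc N) (λ j → (δ 0 j + δ N j) * 1ℚ))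
          ≡⟨ cong (λ x → - ½ * x) (cong₂ _+_ (∑<-const (suc N) 1ℚ) (∑<-δ₂ (λ _ → 1ℚ) (s≤s z≤n) (ℕₚ.n<1+n N))) ⟩
      - ½ * (ℕ→ℚ (suc N) * 1ℚ + (1ℚ + 1ℚ))
          ≡⟨ cong (λ x → - ½ * (x * 1ℚ + (1ℚ + 1ℚ))) (ℕ→ℚ-+ 1 N) ⟩
      - ½ * ((1ℚ + ℕ→ℚ N) * 1ℚ + (1ℚ + 1ℚ))
          ≡⟨ solve 1 (λ n → :- con ½ :* ((con 1ℚ :+ n) :* con 1ℚ :+ (con 1ℚ :+ con 1ℚ)) := :-
              ((con (ℕ→ℚ 3) :+ n) :* con ½)) refl (ℕ→ℚ N) ⟩
      - ((ℕ→ℚ 3 + ℕ→ℚ N) * ½)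
          ≡⟨ cong (λ x → - (x * ½)) (sym (ℕ→ℚ-+ 3 N)) ⟩
      - (ℕ→ℚ (3 ℕ.+ N) * ½)
          ≡⟨ cong -_ (sym (n/[1+d]≡n*1/[1+d] (3 ℕ.+ N) 1)) ⟩
      - c  ∎
      where
      open ≡-Reasoning
      open +-*-Solver hiding (⟦_⟧)
      excess : ∀ s D → - ½ * (s + D) - ½ * (1ℚ - s) ≡ - ½ * (1ℚ + D * 1ℚ)
      excess = solve 2 (λ s D → :- con ½ :* (s :+ D) :- con ½ :* (con 1ℚ :- s) := :- con ½ :*
          (con 1ℚ :+ D :* con 1ℚ)) refl

    excess-at-N : b N - a N ≡ - 1ℚ
    excess-at-N = begin
      - ½ * (sgn N + (δ 0 N + δ N N)) - a N
          ≡⟨ cong₂ (λ x y → - ½ * (x + (y + δ N N)) - a N) (sgn-even 2∣N) (δ-≢ (λ 0≡N → ℕₚ.<-irrefl 0≡N 1≤N)) ⟩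
      - ½ * (1ℚ + (0ℚ + δ N N)) - a N
          ≡⟨ cong₂ (λ x y → - ½ * (1ℚ + (0ℚ + x)) - y) (δ-diag N) (a-closed ℕₚ.≤-refl) ⟩
      - ½ * (1ℚ + (0ℚ + 1ℚ)) - ½ * (1ℚ - sgn N)
          ≡⟨ cong (λ x → - ½ * (1ℚ + (0ℚ + 1ℚ)) - ½ * (1ℚ - x)) (sgn-even 2∣N) ⟩
      - 1ℚ  ∎
      where open ≡-Reasoning

    module _ (s : Sym) where
      open CoefficientsAt s

      coeff-identityI : coeff (⟦ G¹ (suc N) 1 ⟧ ⊖ (c · ⟦ G¹ (suc (suc N)) 0 ⟧ ⊖ Σ[ evensIn 2 N ] P)) s ≡
                        ∑< (suc N) (λ j → a j * p j) + ∑< (suc N) (λ j → b j - a j) * z - (b N - a N) * d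
      coeff-identityI = begin
        coeff (⟦ G¹ (suc N) 1 ⟧ ⊖ (c · ⟦ G¹ (suc (suc N)) 0 ⟧ ⊖ Σ[ evensIn 2 N ] P)) s
            ≡⟨ trans (coeff-⊖ ⟦ G¹ (suc N) 1 ⟧ (c · ⟦ G¹ (suc (suc N)) 0 ⟧ ⊖ Σ[ evensIn 2 N ] P) s)
                     (cong (λ x → d - x) (coeff-⊖ (c · ⟦ G¹ (suc (suc N)) 0 ⟧) (Σ[ evensIn 2 N ] P) s)) ⟩
        d - (coeff (c · ⟦ G¹ (suc (suc N)) 0 ⟧) s - coeff (Σ[ evensIn 2 N ] P) s)
            ≡⟨ cong₂ (λ x y → d - (x - y)) (coeff-· c ⟦ G¹ (suc (suc N)) 0 ⟧ s)
                (coeff-Σ-evensIn-suc 1 N N P s (ℕₚ.n≤1+n N)) ⟩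
        d - (c * z - ∑< (suc N) (λ j → a j * p j))
            ≡⟨ solve 4 (λ A c z d → d :- (c :* z :- A) := A :+ (:- c) :* z :- (:- con 1ℚ) :* d) refl
                (∑< (suc N) (λ j → a j * p j)) c z d ⟩
        ∑< (suc N) (λ j → a j * p j) + (- c) * z - (- 1ℚ) * d
            ≡⟨ cong₂ (λ E e → ∑< (suc N) (λ j → a j * p j) + E * z - e * d) (sym ∑<-excess) (sym excess-at-N) ⟩
        ∑< (suc N) (λ j → a j * p j) + ∑< (suc N) (λ j → b j - a j) * z - (b N - a N) * d  ∎
        where
        open ≡-Reasoning
        open +-*-Solver hiding (⟦_⟧)

    identityI : IdentityI (suc (suc N))
    identityI = combination a b , λ s →
      trans (coeff-identityI s) (sym (CoefficientsAt.coeff-balanced-combination s weights _ (λ _ _ → refl)))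

  -- The second identity

  near-top : ∀ {j n} → j ≤ suc (suc n) → ¬ (suc j ≤ n) → j ≡ n ⊎ j ≡ suc n ⊎ j ≡ suc (suc n)
  near-top {j} {n} j≤2+n 1+j≰n with ℕₚ.m≤n⇒m<n∨m≡n (ℕₚ.≤-pred (ℕₚ.≰⇒> 1+j≰n))
  ... | inj₂ n≡j = inj₁ (sym n≡j)
  ... | inj₁ n<j with ℕₚ.m≤n⇒m<n∨m≡n n<j
  ...   | inj₂ 1+n≡j = inj₂ (inj₁ (sym 1+n≡j))
  ...   | inj₁ 1+n<j = inj₂ (inj₂ (ℕₚ.≤-antisym j≤2+n 1+n<j))

  IdentityII : ℕ → Set
  IdentityII k = ((ℤ.+ (suc k ℕ.* (k ∸ 1) ℕ.* (k ∸ 6)) / 12) · ⟦ G¹ k 0 ⟧) ≈[ k ]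
    (Σ[ evensIn 4 (k ∸ 4) ] λ k₁ → ℕ→ℚ ((k₁ ∸ 1) ℕ.* (k ∸ k₁ ∸ 1)) · ⟦ Pˢ k₁ (k ∸ k₁) 0 0 ⟧)

  module SecondIdentity {M : ℕ} (2∣M : 2 ∣ M) where

    N : ℕ
    N = suc (suc (suc (suc M)))

    open ZeroLowerIndices N

    sgn-M : sgn M ≡ 1ℚ
    sgn-M = sgn-even 2∣M

    2∣N : 2 ∣ N
    2∣N = ∣m∣n⇒∣m+n (divides 2 refl) 2∣M

    ω : ℕ → ℚ
    ω j = ℕ→ℚ (j ℕ.* (N ∸ j))

    n₁ : ℚ
    n₁ = ℕ→ℚ (N ∸ 1)

    c : ℚ
    c = ℤ.+ (suc (suc (suc N)) ℕ.* (suc N) ℕ.* M) / 12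

    Q : ℕ → FSum
    Q k₁ = ℕ→ℚ ((k₁ ∸ 1) ℕ.* (suc (suc N) ∸ k₁ ∸ 1)) · ⟦ Pˢ k₁ (suc (suc N) ∸ k₁) 0 0 ⟧

    v a b : ℕ → ℚ
    v j = evenWindow 4 (N ∸ 2) (suc j) * ω j
    a j = - v j
    b j = ½ * (sgn j * ω j) + ½ * n₁ * (δ 1 j + δ (N ∸ 1) j) - (δ 2 j + δ (N ∸ 2) j)

    -- Among the odd j, the window 4 ≤ j + 1 ≤ N − 2 excludes exactly j = 1 and j = N − 1.
    v-formula : ℕ → ℚ
    v-formula j = ½ * (1ℚ - sgn j) * ω j - n₁ * (δ 1 j + δ (N ∸ 1) j)

    v-outside : ∀ {j} → ¬ (suc j ≤ N ∸ 2) → v j ≡ 0ℚ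
    v-outside {j} outer = begin
      𝟙 (does (4 ℕ.≤? suc j) ∧ does (suc j ℕ.≤? N ∸ 2)) * 𝟙 (does (2 ∣? suc j)) * ω j
          ≡⟨ cong (λ w → 𝟙 (does (4 ℕ.≤? suc j) ∧ w) * 𝟙 (does (2 ∣? suc j)) * ω j)
              (dec-false (suc j ℕ.≤? N ∸ 2) outer) ⟩
      𝟙 (does (4 ℕ.≤? suc j) ∧ false) * 𝟙 (does (2 ∣? suc j)) * ω j
          ≡⟨ cong (λ w → 𝟙 w * 𝟙 (does (2 ∣? suc j)) * ω j) (∧-zeroʳ (does (4 ℕ.≤? suc j))) ⟩
      0ℚ * 𝟙 (does (2 ∣? suc j)) * ω j
          ≡⟨ trans (cong (_* ω j) (ℚₚ.*-zeroˡ (𝟙 (does (2 ∣? suc j))))) (ℚₚ.*-zeroˡ (ω j)) ⟩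
      0ℚ  ∎
      where open ≡-Reasoning

    v-inside : ∀ {j} → suc j ≤ N ∸ 2 → v j ≡ 𝟙 (does (4 ℕ.≤? suc j)) * 𝟙 (does (2 ∣? suc j)) * ω j
    v-inside {j} inner = cong (λ w → 𝟙 w * 𝟙 (does (2 ∣? suc j)) * ω j)
      (trans (cong (does (4 ℕ.≤? suc j) ∧_) (dec-true (suc j ℕ.≤? N ∸ 2) inner)) (∧-identityʳ (does (4 ℕ.≤? suc j))))

    v-formula-near-top : ∀ {j} → j ≤ N → ¬ (suc j ≤ N ∸ 2) → v-formula j ≡ 0ℚ
    v-formula-near-top {j} j≤N outer with near-top j≤N outer
    ... | inj₁ refl = begin
      ½ * (1ℚ - sgn (2 ℕ.+ M)) * ω (2 ℕ.+ M) - n₁ * (0ℚ + δ (3 ℕ.+ M) (2 ℕ.+ M))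
          ≡⟨ cong₂ (λ s d → ½ * (1ℚ - s) * ω (2 ℕ.+ M) - n₁ * (0ℚ + d)) (cong (λ x → - - x) sgn-M)
              (δ-≢ (ℕₚ.1+n≢n {suc (suc M)})) ⟩
      ½ * (1ℚ - 1ℚ) * ω (2 ℕ.+ M) - n₁ * (0ℚ + 0ℚ)
          ≡⟨ solve 2 (λ w n → con ½ :* (con 1ℚ :- con 1ℚ) :* w :- n :* (con 0ℚ :+ con 0ℚ) := con 0ℚ) refl
              (ω (2 ℕ.+ M)) n₁ ⟩
      0ℚ  ∎
      where
      open ≡-Reasoning
      open +-*-Solver hiding (⟦_⟧)
    ... | inj₂ (inj₁ refl) = begin
      ½ * (1ℚ - sgn (3 ℕ.+ M)) * ℕ→ℚ ((3 ℕ.+ M) ℕ.* (suc M ∸ M)) - n₁ * (0ℚ + δ (3 ℕ.+ M) (3 ℕ.+ M))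
          ≡⟨ cong₂ (λ s d → ½ * (1ℚ - s) * ℕ→ℚ ((3 ℕ.+ M) ℕ.* (suc M ∸ M)) - n₁ * (0ℚ + d))
              (cong (λ x → - - - x) sgn-M) (δ-diag (3 ℕ.+ M)) ⟩
      ½ * (1ℚ - - 1ℚ) * ℕ→ℚ ((3 ℕ.+ M) ℕ.* (suc M ∸ M)) - n₁ * (0ℚ + 1ℚ)
          ≡⟨ cong (λ k → ½ * (1ℚ - - 1ℚ) * ℕ→ℚ k - n₁ * (0ℚ + 1ℚ))
              (trans (cong ((3 ℕ.+ M) ℕ.*_) (ℕₚ.m+n∸n≡m 1 M)) (ℕₚ.*-identityʳ (3 ℕ.+ M))) ⟩
      ½ * (1ℚ - - 1ℚ) * n₁ - n₁ * (0ℚ + 1ℚ)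
          ≡⟨ solve 1 (λ n → con ½ :* (con 1ℚ :- (:- con 1ℚ)) :* n :- n :* (con 0ℚ :+ con 1ℚ) := con 0ℚ) refl n₁ ⟩
      0ℚ  ∎
      where
      open ≡-Reasoning
      open +-*-Solver hiding (⟦_⟧)
    ... | inj₂ (inj₂ refl) = begin
      ½ * (1ℚ - sgn N) * ℕ→ℚ (N ℕ.* (M ∸ M)) - n₁ * (0ℚ + δ (3 ℕ.+ M) N)
          ≡⟨ cong₂ (λ k d → ½ * (1ℚ - sgn N) * ℕ→ℚ k - n₁ * (0ℚ + d))
              (trans (cong (N ℕ.*_) (ℕₚ.n∸n≡0 M)) (ℕₚ.*-zeroʳ N)) (δ-≢ {3 ℕ.+ M} {N} (ℕₚ.1+n≢n ∘ sym)) ⟩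
      ½ * (1ℚ - sgn N) * 0ℚ - n₁ * (0ℚ + 0ℚ)
          ≡⟨ solve 2 (λ s n → con ½ :* (con 1ℚ :- s) :* con 0ℚ :- n :* (con 0ℚ :+ con 0ℚ) := con 0ℚ) refl (sgn N) n₁ ⟩
      0ℚ  ∎
      where
      open ≡-Reasoning
      open +-*-Solver hiding (⟦_⟧)

    v-closed-inside : ∀ {j} → suc j ≤ N ∸ 2 → v j ≡ v-formula j
    v-closed-inside {zero} _ = solve 1 (λ n → con 0ℚ := con 0ℚ :- n :* (con 0ℚ :+ con 0ℚ)) refl n₁
      where open +-*-Solver hiding (⟦_⟧)
    v-closed-inside {suc zero} inner = begin
      v 1
          ≡⟨ v-inside inner ⟩
      0ℚ * 0ℚ * ω 1
          ≡⟨ cong (λ k → 0ℚ * 0ℚ * ℕ→ℚ k) (ℕₚ.*-identityˡ (3 ℕ.+ M)) ⟩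
      0ℚ * 0ℚ * n₁
          ≡⟨ solve 1 (λ n → con 0ℚ :* con 0ℚ :* n := con ½ :* (con 1ℚ :- (:- con 1ℚ)) :* n :- n :*
              (con 1ℚ :+ con 0ℚ)) refl n₁ ⟩
      ½ * (1ℚ - - 1ℚ) * n₁ - n₁ * (1ℚ + 0ℚ)
          ≡⟨ cong (λ k → ½ * (1ℚ - - 1ℚ) * ℕ→ℚ k - n₁ * (1ℚ + 0ℚ)) (sym (ℕₚ.*-identityˡ (3 ℕ.+ M))) ⟩
      v-formula 1  ∎
      where
      open ≡-Reasoning
      open +-*-Solver hiding (⟦_⟧)
    v-closed-inside {suc (suc zero)} inner = begin
      v 2
          ≡⟨ v-inside inner ⟩
      0ℚ * 1ℚ * ω 2
          ≡⟨ solve 2 (λ w n → con 0ℚ :* con 1ℚ :* w := con ½ :* (con 1ℚ :- con 1ℚ) :* w :- n :*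
              (con 0ℚ :+ con 0ℚ)) refl (ω 2) n₁ ⟩
      v-formula 2  ∎
      where
      open ≡-Reasoning
      open +-*-Solver hiding (⟦_⟧)
    v-closed-inside {suc (suc (suc j))} inner = begin
      v (3 ℕ.+ j)
          ≡⟨ v-inside inner ⟩
      1ℚ * 𝟙 (does (2 ∣? suc (3 ℕ.+ j))) * ω (3 ℕ.+ j)
          ≡⟨ cong (λ x → 1ℚ * x * ω (3 ℕ.+ j)) (𝟙[2∣1+j]≡½[1-sgn[j]] (3 ℕ.+ j)) ⟩
      1ℚ * (½ * (1ℚ - sgn (3 ℕ.+ j))) * ω (3 ℕ.+ j)
          ≡⟨ solve 3 (λ s w n → con 1ℚ :* (con ½ :* (con 1ℚ :- s)) :* w := con ½ :* (con 1ℚ :- s) :* w :- n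
              :* (con 0ℚ :+ con 0ℚ)) refl (sgn (3 ℕ.+ j)) (ω (3 ℕ.+ j)) n₁ ⟩
      ½ * (1ℚ - sgn (3 ℕ.+ j)) * ω (3 ℕ.+ j) - n₁ * (0ℚ + 0ℚ)
          ≡⟨ cong (λ d → ½ * (1ℚ - sgn (3 ℕ.+ j)) * ω (3 ℕ.+ j) - n₁ * (0ℚ + d)) (sym (δ-≢ M≢j)) ⟩
      v-formula (3 ℕ.+ j)  ∎
      where
      open ≡-Reasoning
      open +-*-Solver hiding (⟦_⟧)
      M≢j : M ≢ j
      M≢j M≡j = ℕₚ.<-irrefl (sym M≡j) (ℕₚ.≤-trans (ℕₚ.n≤1+n (suc j)) (ℕₚ.≤-pred (ℕₚ.≤-pred inner)))

    v-closed : ∀ {j} → j ≤ N → v j ≡ v-formula j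
    v-closed {j} j≤N with suc j ℕ.≤? N ∸ 2
    ... | yes inner = v-closed-inside inner
    ... | no  outer = trans (v-outside outer) (sym (v-formula-near-top j≤N outer))

    a-symmetric : ∀ {j} → j ≤ N → a (N ∸ j) ≡ a j
    a-symmetric {j} j≤N = cong -_ (begin
      v (N ∸ j)
          ≡⟨ v-closed (ℕₚ.m∸n≤m N j) ⟩
      v-formula (N ∸ j)
          ≡⟨ cong₃ (sgn-reflect 2∣N j≤N) (ℕ→ℚ[j*[N∸j]]-reflect j≤N) (δ-pair-reflect (s≤s z≤n) j≤N) ⟩
      v-formula j
          ≡⟨ sym (v-closed j≤N) ⟩
      v j  ∎)
      where
      open ≡-Reasoning
      cong₃ : ∀ {s s′ w w′ d d′} → s ≡ s′ → w ≡ w′ → d ≡ d′ → ½ * (1ℚ - s) * w - n₁ * d ≡ ½ * (1ℚ - s′) * w′ - n₁ * d′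
      cong₃ refl refl refl = refl

    b-symmetric : ∀ {j} → j ≤ N → b (N ∸ j) ≡ b j
    b-symmetric {j} j≤N = cong₄ (sgn-reflect 2∣N j≤N) (ℕ→ℚ[j*[N∸j]]-reflect j≤N)
        (δ-pair-reflect (s≤s z≤n) j≤N) (δ-pair-reflect (s≤s (s≤s z≤n)) j≤N)
      where
      cong₄ : ∀ {s s′ w w′ d d′ e e′} → s ≡ s′ → w ≡ w′ → d ≡ d′ → e ≡ e′ →
              ½ * (s * w) + ½ * n₁ * d - e ≡ ½ * (s′ * w′) + ½ * n₁ * d′ - e′
      cong₄ refl refl refl refl = refl

    ∑<-sgn*ω*binom : ∀ {i} → i ≤ N → ∑< (suc N) (λ j → sgn j * (ω j * binom i j)) ≡ - n₁ * δ 1 i - ℕ→ℚ 2 * δ 2 i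
    ∑<-sgn*ω*binom {i} i≤N = begin
      ∑< (suc N) (λ j → sgn j * (ω j * binom i j))
          ≡⟨ ∑<-cong (suc N) (λ j j<1+N → trans
              (cong (λ x → sgn j * (x * binom i j)) (ℕ→ℚ[j*[N∸j]]-falling (s≤s z≤n) (ℕₚ.≤-pred j<1+N)))
                                                 (split n₁ (sgn j) (ℕ→ℚ (j ↓ 1)) (ℕ→ℚ (j ↓ 2)) (binom i j))) ⟩
      ∑< (suc N) (λ j → n₁ * (sgn j * (ℕ→ℚ (j ↓ 1) * binom i j)) - sgn j * (ℕ→ℚ (j ↓ 2) * binom i j))
          ≡⟨ ∑<-distrib-- (suc N) (λ j → n₁ * (sgn j * (ℕ→ℚ (j ↓ 1) * binom i j)))
              (λ j → sgn j * (ℕ→ℚ (j ↓ 2) * binom i j)) ⟩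
      ∑< (suc N) (λ j → n₁ * (sgn j * (ℕ→ℚ (j ↓ 1) * binom i j))) - ∑< (suc N) (λ j → sgn j * (ℕ→ℚ (j ↓ 2) * binom i j))
          ≡⟨ cong (_- ∑< (suc N) (λ j → sgn j * (ℕ→ℚ (j ↓ 2) * binom i j)))
              (sym (*-distribˡ-∑< (suc N) n₁ (λ j → sgn j * (ℕ→ℚ (j ↓ 1) * binom i j)))) ⟩
      n₁ * ∑< (suc N) (λ j → sgn j * (ℕ→ℚ (j ↓ 1) * binom i j)) - ∑< (suc N) (λ j → sgn j * (ℕ→ℚ (j ↓ 2) * binom i j))
          ≡⟨ cong₂ (λ x y → n₁ * x - y) (∑<-alternating-binom 1 i≤N) (∑<-alternating-binom 2 i≤N) ⟩
      n₁ * (- 1ℚ * (1ℚ * δ 1 i)) - 1ℚ * (ℕ→ℚ 2 * δ 2 i)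
          ≡⟨ solve 3 (λ n d₁ d₂ → n :* ((:- con 1ℚ) :* (con 1ℚ :* d₁)) :- con 1ℚ :* (con (ℕ→ℚ 2) :* d₂) :=
              (:- n) :* d₁ :- con (ℕ→ℚ 2) :* d₂) refl n₁ (δ 1 i) (δ 2 i) ⟩
      - n₁ * δ 1 i - ℕ→ℚ 2 * δ 2 i  ∎
      where
      open ≡-Reasoning
      open +-*-Solver hiding (⟦_⟧)
      split : ∀ n s f₁ f₂ c → s * ((n * f₁ - f₂) * c) ≡ n * (s * (f₁ * c)) - s * (f₂ * c)
      split = solve 5 (λ n s f₁ f₂ c → s :* ((n :* f₁ :- f₂) :* c) := n :* (s :* (f₁ :* c)) :- s :* (f₂ :* c)) refl

    balanced : ∀ {i} → i ≤ N → ∑< (suc N) (λ j → b j * binom i j) ≡ b i - a i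
    balanced {i} i≤N = begin
      ∑< (suc N) (λ j → b j * binom i j)
          ≡⟨ ∑<-cong (suc N) (λ j _ → expand (sgn j) (ω j) n₁ (δ 1 j + δ (N ∸ 1) j) (δ 2 j + δ (N ∸ 2) j) (binom i j)) ⟩
      ∑< (suc N) (λ j → ½ * (sgn j * (ω j * binom i j)) + ½ * n₁ * ((δ 1 j + δ (N ∸ 1) j) * binom i j) -
          (δ 2 j + δ (N ∸ 2) j) * binom i j)
          ≡⟨ ∑<-linear (suc N) ½ (½ * n₁) (λ j → sgn j * (ω j * binom i j))
              (λ j → (δ 1 j + δ (N ∸ 1) j) * binom i j) (λ j → (δ 2 j + δ (N ∸ 2) j) * binom i j) ⟩
      ½ * ∑< (suc N) (λ j → sgn j * (ω j * binom i j)) + ½ * n₁ * ∑< (suc N) (λ j → (δ 1 j + δ (N ∸ 1) j) * binom i j)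
        - ∑< (suc N) (λ j → (δ 2 j + δ (N ∸ 2) j) * binom i j)
          ≡⟨ cong₃ (∑<-sgn*ω*binom i≤N) (∑<-δ₂ (binom i) (s≤s (s≤s z≤n)) (s≤s (ℕₚ.n≤1+n (3 ℕ.+ M))))
                   (∑<-δ₂ (binom i) (s≤s (s≤s (s≤s z≤n))) (s≤s (ℕₚ.m≤n⇒m≤1+n (ℕₚ.n≤1+n (2 ℕ.+ M))))) ⟩
      ½ * (- n₁ * δ 1 i - ℕ→ℚ 2 * δ 2 i) + ½ * n₁ * (binom i 1 + binom i (3 ℕ.+ M)) - (binom i 2 + binom i (2 ℕ.+ M))
          ≡⟨ cong₂ (λ x y → ½ * (- n₁ * δ 1 i - ℕ→ℚ 2 * δ 2 i) + ½ * n₁ * x - y)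
                   (cong₂ _+_ (cong ℕ→ℚ (nC1≡n i)) (binom-below-diag i≤N))
                   (cong₂ _+_ (binom-n-2 i)
                       (trans (binom-below-diag₂ i≤N) (cong (λ x → δ (2 ℕ.+ M) i + n₁ * δ (3 ℕ.+ M) i + x * δ N i)
                                                                                    (trans (binom-[2+n]-n
                                                                                        (2 ℕ.+ M)) (binom-n-2 N))))) ⟩
      ½ * (- n₁ * δ 1 i - ℕ→ℚ 2 * δ 2 i) + ½ * n₁ * (I + (δ (3 ℕ.+ M) i + Nq * δ N i))
        - (½ * (I * (I - 1ℚ)) + (δ (2 ℕ.+ M) i + n₁ * δ (3 ℕ.+ M) i + ½ * (Nq * (Nq - 1ℚ)) * δ N i))
          ≡⟨ cong (λ m → ½ * (- n₁ * δ 1 i - ℕ→ℚ 2 * δ 2 i) + ½ * n₁ * (I + (δ (3 ℕ.+ M) i + m * δ N i))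
                           - (½ * (I * (I - 1ℚ)) +
                               (δ (2 ℕ.+ M) i + n₁ * δ (3 ℕ.+ M) i + ½ * (m * (m - 1ℚ)) * δ N i))) (ℕ→ℚ-+ 1 (3 ℕ.+ M)) ⟩
      ½ * (- n₁ * δ 1 i - ℕ→ℚ 2 * δ 2 i) + ½ * n₁ * (I + (δ (3 ℕ.+ M) i + (1ℚ + n₁) * δ N i))
        - (½ * (I * (I - 1ℚ)) + (δ (2 ℕ.+ M) i + n₁ * δ (3 ℕ.+ M) i + ½ * ((1ℚ + n₁) * ((1ℚ + n₁) - 1ℚ)) * δ N i))
          ≡⟨ solve 8 (λ s I n d₁ d₂ d₃ d₄ d₅ →
                con ½ :* ((:- n) :* d₁ :- con (ℕ→ℚ 2) :* d₂) :+ con ½ :* n :* (I :+ (d₄ :+ (con 1ℚ :+ n) :* d₅))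
                  :- (con ½ :* (I :* (I :- con 1ℚ)) :+
                      (d₃ :+ n :* d₄ :+ con ½ :* ((con 1ℚ :+ n) :* ((con 1ℚ :+ n) :- con 1ℚ)) :* d₅))
                := con ½ :* (s :* (I :* ((con 1ℚ :+ n) :- I))) :+ con ½ :* n :* (d₁ :+ d₄) :- (d₂ :+ d₃)
                  :- (:- (con ½ :* (con 1ℚ :- s) :* (I :* ((con 1ℚ :+ n) :- I)) :- n :* (d₁ :+ d₄))))
               refl (sgn i) I n₁ (δ 1 i) (δ 2 i) (δ (2 ℕ.+ M) i) (δ (3 ℕ.+ M) i) (δ N i) ⟩
      ½ * (sgn i * (I * ((1ℚ + n₁) - I))) + ½ * n₁ * (δ 1 i + δ (3 ℕ.+ M) i) - (δ 2 i + δ (2 ℕ.+ M) i)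
        - - (½ * (1ℚ - sgn i) * (I * ((1ℚ + n₁) - I)) - n₁ * (δ 1 i + δ (3 ℕ.+ M) i))
          ≡⟨ cong (λ w → ½ * (sgn i * w) + ½ * n₁ * (δ 1 i + δ (3 ℕ.+ M) i) - (δ 2 i + δ (2 ℕ.+ M) i)
                           - - (½ * (1ℚ - sgn i) * w - n₁ * (δ 1 i + δ (3 ℕ.+ M) i)))
                 (sym (trans (ℕ→ℚ[j*[N∸j]] i≤N) (cong (λ m → I * (m - I)) (ℕ→ℚ-+ 1 (3 ℕ.+ M))))) ⟩
      b i - - v-formula i
          ≡⟨ cong (λ x → b i - - x) (sym (v-closed i≤N)) ⟩
      b i - a i  ∎
      where
      open ≡-Reasoning
      open +-*-Solver hiding (⟦_⟧)
      I = ℕ→ℚ i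
      Nq = ℕ→ℚ N
      expand : ∀ s w n d e c → (½ * (s * w) + ½ * n * d - e) * c ≡ ½ * (s * (w * c)) + ½ * n * (d * c) - e * c
      expand = solve 6 (λ s w n d e c → (con ½ :* (s :* w) :+ con ½ :* n :* d :- e) :* c := con ½ :*
          (s :* (w :* c)) :+ con ½ :* n :* (d :* c) :- e :* c) refl
      cong₃ : ∀ {x x′ y y′ z z′} → x ≡ x′ → y ≡ y′ → z ≡ z′ → ½ * x + ½ * n₁ * y - z ≡ ½ * x′ + ½ * n₁ * y′ - z′
      cong₃ refl refl refl = refl

    weights : BalancedWeights
    weights = record { a = a ; b = b ; a-symmetric = a-symmetric ; b-symmetric = b-symmetric ; balanced = balanced }

    ∑<-ω : ℕ→ℚ 6 * ∑< (suc N) ω ≡ ℕ→ℚ N * (ℕ→ℚ N + 1ℚ) * (ℕ→ℚ N - 1ℚ)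
    ∑<-ω = begin
      ℕ→ℚ 6 * ∑< (suc N) ω
          ≡⟨ cong (ℕ→ℚ 6 *_) (∑<-cong (suc N) (λ j j<1+N → ℕ→ℚ[j*[N∸j]] (ℕₚ.≤-pred j<1+N))) ⟩
      ℕ→ℚ 6 * ∑< (suc N) (λ j → ℕ→ℚ j * (ℕ→ℚ N - ℕ→ℚ j))
          ≡⟨ 6*∑<-j*[x-j] (suc N) (ℕ→ℚ N) ⟩
      ℕ→ℚ 3 * ℕ→ℚ N * ℕ→ℚ (suc N) * (ℕ→ℚ (suc N) - 1ℚ) - (ℕ→ℚ (suc N) - 1ℚ) * ℕ→ℚ (suc N) * (ℕ→ℚ 2 * ℕ→ℚ (suc N) - 1ℚ)
          ≡⟨ cong (λ x → ℕ→ℚ 3 * ℕ→ℚ N * x * (x - 1ℚ) - (x - 1ℚ) * x * (ℕ→ℚ 2 * x - 1ℚ)) (ℕ→ℚ-+ 1 N) ⟩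
      ℕ→ℚ 3 * ℕ→ℚ N * (1ℚ + ℕ→ℚ N) * ((1ℚ + ℕ→ℚ N) - 1ℚ) - ((1ℚ + ℕ→ℚ N) - 1ℚ) * (1ℚ + ℕ→ℚ N) *
          (ℕ→ℚ 2 * (1ℚ + ℕ→ℚ N) - 1ℚ)
          ≡⟨ solve 1 (λ n → con (ℕ→ℚ 3) :* n :* (con 1ℚ :+ n) :* ((con 1ℚ :+ n) :- con 1ℚ) :-
              ((con 1ℚ :+ n) :- con 1ℚ) :* (con 1ℚ :+ n) :* (con (ℕ→ℚ 2) :* (con 1ℚ :+ n) :- con 1ℚ)
                           := n :* (n :+ con 1ℚ) :* (n :- con 1ℚ)) refl (ℕ→ℚ N) ⟩
      ℕ→ℚ N * (ℕ→ℚ N + 1ℚ) * (ℕ→ℚ N - 1ℚ)  ∎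
      where
      open ≡-Reasoning
      open +-*-Solver hiding (⟦_⟧)

    ∑<-excess : ∑< (suc N) (λ j → b j - a j) ≡ c
    ∑<-excess = begin
      ∑< (suc N) (λ j → b j - a j)
          ≡⟨ ∑<-cong (suc N) (λ j j<1+N → trans (cong (λ x → b j - - x) (v-closed (ℕₚ.≤-pred j<1+N)))
                                                 (excess (sgn j) (ω j) n₁ (δ 1 j + δ (N ∸ 1) j)
                                                     (δ 2 j + δ (N ∸ 2) j))) ⟩
      ∑< (suc N) (λ j → ½ * ω j + - ½ * n₁ * ((δ 1 j + δ (N ∸ 1) j) * 1ℚ) - (δ 2 j + δ (N ∸ 2) j) * 1ℚ)
          ≡⟨ ∑<-linear (suc N) ½ (- ½ * n₁) ω (λ j → (δ 1 j + δ (N ∸ 1) j) * 1ℚ) (λ j → (δ 2 j + δ (N ∸ 2) j) * 1ℚ) ⟩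
      ½ * ∑< (suc N) ω + - ½ * n₁ * ∑< (suc N) (λ j → (δ 1 j + δ (N ∸ 1) j) * 1ℚ) - ∑< (suc N)
          (λ j → (δ 2 j + δ (N ∸ 2) j) * 1ℚ)
          ≡⟨ cong₂ (λ x y → ½ * ∑< (suc N) ω + - ½ * n₁ * x - y)
                   (∑<-δ₂ (λ _ → 1ℚ) (s≤s (s≤s z≤n)) (s≤s (ℕₚ.n≤1+n (3 ℕ.+ M))))
                   (∑<-δ₂ (λ _ → 1ℚ) (s≤s (s≤s (s≤s z≤n))) (s≤s (ℕₚ.m≤n⇒m≤1+n (ℕₚ.n≤1+n (2 ℕ.+ M))))) ⟩
      ½ * ∑< (suc N) ω + - ½ * n₁ * (1ℚ + 1ℚ) - (1ℚ + 1ℚ)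
          ≡⟨ cong (λ x → ½ * x + - ½ * n₁ * (1ℚ + 1ℚ) - (1ℚ + 1ℚ))
                  (trans (solve 1 (λ x → x := con (ℤ.+ 1 / 6) :* (con (ℕ→ℚ 6) :* x)) refl (∑< (suc N) ω))
                      (cong (ℤ.+ 1 / 6 *_) ∑<-ω)) ⟩
      ½ * (ℤ.+ 1 / 6 * (ℕ→ℚ N * (ℕ→ℚ N + 1ℚ) * (ℕ→ℚ N - 1ℚ))) + - ½ * n₁ * (1ℚ + 1ℚ) - (1ℚ + 1ℚ)
          ≡⟨ cong₂ (λ x y → ½ * (ℤ.+ 1 / 6 * (x * (x + 1ℚ) * (x - 1ℚ))) + - ½ * y * (1ℚ + 1ℚ) - (1ℚ + 1ℚ))
              (ℕ→ℚ-+ 4 M) (ℕ→ℚ-+ 3 M) ⟩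
      ½ * (ℤ.+ 1 / 6 * ((ℕ→ℚ 4 + m) * ((ℕ→ℚ 4 + m) + 1ℚ) * ((ℕ→ℚ 4 + m) - 1ℚ))) + - ½ * (ℕ→ℚ 3 + m) *
          (1ℚ + 1ℚ) - (1ℚ + 1ℚ)
          ≡⟨ solve 1 (λ m → con ½ :*
              (con (ℤ.+ 1 / 6) :* ((con (ℕ→ℚ 4) :+ m) :* ((con (ℕ→ℚ 4) :+ m) :+ con 1ℚ) :*
                  ((con (ℕ→ℚ 4) :+ m) :- con 1ℚ)))
                              :+ (:- con ½) :* (con (ℕ→ℚ 3) :+ m) :* (con 1ℚ :+ con 1ℚ) :- (con 1ℚ :+ con 1ℚ)
                           := (con (ℕ→ℚ 7) :+ m) :* (con (ℕ→ℚ 5) :+ m) :* m :* con (ℤ.+ 1 / 12)) refl m ⟩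
      (ℕ→ℚ 7 + m) * (ℕ→ℚ 5 + m) * m * (ℤ.+ 1 / 12)
          ≡⟨ cong₂ (λ x y → x * y * m * (ℤ.+ 1 / 12)) (sym (ℕ→ℚ-+ 7 M)) (sym (ℕ→ℚ-+ 5 M)) ⟩
      ℕ→ℚ (7 ℕ.+ M) * ℕ→ℚ (5 ℕ.+ M) * m * (ℤ.+ 1 / 12)
          ≡⟨ cong (_* (ℤ.+ 1 / 12))
              (sym (trans (ℕ→ℚ-* (suc (suc (suc N)) ℕ.* suc N) M) (cong (_* m) (ℕ→ℚ-* (suc (suc (suc N))) (suc N))))) ⟩
      ℕ→ℚ (suc (suc (suc N)) ℕ.* suc N ℕ.* M) * (ℤ.+ 1 / 12)
          ≡⟨ sym (n/[1+d]≡n*1/[1+d] (suc (suc (suc N)) ℕ.* suc N ℕ.* M) 11) ⟩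
      c  ∎
      where
      open ≡-Reasoning
      open +-*-Solver hiding (⟦_⟧)
      m = ℕ→ℚ M
      excess : ∀ s w n D E → ½ * (s * w) + ½ * n * D - E - - (½ * (1ℚ - s) * w - n * D) ≡ ½ * w + - ½ * n *
          (D * 1ℚ) - E * 1ℚ
      excess = solve 5 (λ s w n D E → con ½ :* (s :* w) :+ con ½ :* n :* D :- E :-
          (:- (con ½ :* (con 1ℚ :- s) :* w :- n :* D))
                                    := con ½ :* w :+ (:- con ½) :* n :* (D :* con 1ℚ) :- E :* con 1ℚ) refl

    excess-at-N : b N - a N ≡ 0ℚ
    excess-at-N = begin
      ½ * (sgn N * ℕ→ℚ (N ℕ.* (M ∸ M))) + ½ * n₁ * (0ℚ + δ (3 ℕ.+ M) N) - (0ℚ + δ (2 ℕ.+ M) N) - - v N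
          ≡⟨ cong₄ (trans (cong (λ k → N ℕ.* k) (ℕₚ.n∸n≡0 M)) (ℕₚ.*-zeroʳ N)) (δ-≢ {3 ℕ.+ M} {N} (ℕₚ.1+n≢n ∘ sym))
                   (δ-≢ {2 ℕ.+ M} {N} (λ eq → ℕₚ.<-irrefl eq (ℕₚ.m<n⇒m<1+n (ℕₚ.n<1+n (2 ℕ.+ M)))))
                       (v-outside (λ 1+N≤N∸2 → ℕₚ.1+n≰n (ℕₚ.≤-trans 1+N≤N∸2 (ℕₚ.m∸n≤m N 2)))) ⟩
      ½ * (sgn N * 0ℚ) + ½ * n₁ * (0ℚ + 0ℚ) - (0ℚ + 0ℚ) - - 0ℚ
          ≡⟨ solve 2 (λ s n → con ½ :* (s :* con 0ℚ) :+ con ½ :* n :* (con 0ℚ :+ con 0ℚ) :-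
              (con 0ℚ :+ con 0ℚ) :- (:- con 0ℚ) := con 0ℚ) refl (sgn N) n₁ ⟩
      0ℚ  ∎
      where
      open ≡-Reasoning
      open +-*-Solver hiding (⟦_⟧)
      cong₄ : ∀ {k k′ d d′ e e′ x x′} → k ≡ k′ → d ≡ d′ → e ≡ e′ → x ≡ x′ →
              ½ * (sgn N * ℕ→ℚ k) + ½ * n₁ * (0ℚ + d) - (0ℚ + e) - - x ≡ ½ * (sgn N * ℕ→ℚ k′) + ½ * n₁ *
                  (0ℚ + d′) - (0ℚ + e′) - - x′
      cong₄ refl refl refl refl = refl

    module _ (s : Sym) where
      open CoefficientsAt s

      coeff-identityII : coeff ((c · ⟦ G¹ (suc (suc N)) 0 ⟧) ⊖ Σ[ evensIn 4 (N ∸ 2) ] Q) s ≡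
                         ∑< (suc N) (λ j → a j * p j) + ∑< (suc N) (λ j → b j - a j) * z - (b N - a N) * d
      coeff-identityII = begin
        coeff ((c · ⟦ G¹ (suc (suc N)) 0 ⟧) ⊖ Σ[ evensIn 4 (N ∸ 2) ] Q) s
            ≡⟨ coeff-⊖ (c · ⟦ G¹ (suc (suc N)) 0 ⟧) (Σ[ evensIn 4 (N ∸ 2) ] Q) s ⟩
        coeff (c · ⟦ G¹ (suc (suc N)) 0 ⟧) s - coeff (Σ[ evensIn 4 (N ∸ 2) ] Q) s
            ≡⟨ cong₂ _-_ (coeff-· c ⟦ G¹ (suc (suc N)) 0 ⟧ s)
                (coeff-Σ-evensIn-suc 3 (N ∸ 2) N Q s (ℕₚ.m≤n⇒m≤1+n (ℕₚ.m∸n≤m N 2))) ⟩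
        c * z - ∑< (suc N) (λ j → evenWindow 4 (N ∸ 2) (suc j) * coeff (Q (suc j)) s)
            ≡⟨ cong (λ x → c * z - x) (∑<-cong (suc N) (λ j j<1+N → weighted-P (ℕₚ.≤-pred j<1+N))) ⟩
        c * z - ∑< (suc N) (λ j → v j * p j)
            ≡⟨ solve 4 (λ A c z d → c :* z :- A := (:- A) :+ c :* z :- con 0ℚ :* d) refl
                (∑< (suc N) (λ j → v j * p j)) c z d ⟩
        - ∑< (suc N) (λ j → v j * p j) + c * z - 0ℚ * d
            ≡⟨ cong₃ (trans (sym (∑<-neg (suc N) (λ j → v j * p j)))
                (∑<-cong (suc N) (λ j _ → ℚₚ.neg-distribˡ-* (v j) (p j))))
                     (sym ∑<-excess) (sym excess-at-N) ⟩
        ∑< (suc N) (λ j → a j * p j) + ∑< (suc N) (λ j → b j - a j) * z - (b N - a N) * d  ∎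
        where
        open ≡-Reasoning
        open +-*-Solver hiding (⟦_⟧)
        weighted-P : ∀ {j} → j ≤ N → evenWindow 4 (N ∸ 2) (suc j) * coeff (Q (suc j)) s ≡ v j * p j
        weighted-P {j} j≤N = begin
          evenWindow 4 (N ∸ 2) (suc j) * coeff (Q (suc j)) s
              ≡⟨ cong (evenWindow 4 (N ∸ 2) (suc j) *_)
                  (coeff-· (ℕ→ℚ (j ℕ.* (suc N ∸ j ∸ 1))) ⟦ Pˢ (suc j) (suc N ∸ j) 0 0 ⟧ s) ⟩
          evenWindow 4 (N ∸ 2) (suc j) * (ℕ→ℚ (j ℕ.* (suc N ∸ j ∸ 1)) * p j)
              ≡⟨ cong (λ k → evenWindow 4 (N ∸ 2) (suc j) * (ℕ→ℚ (j ℕ.* k) * p j)) (cong (_∸ 1) (1+N∸j≡1+[N∸j] j≤N)) ⟩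
          evenWindow 4 (N ∸ 2) (suc j) * (ω j * p j)
              ≡⟨ sym (ℚₚ.*-assoc (evenWindow 4 (N ∸ 2) (suc j)) (ω j) (p j)) ⟩
          v j * p j  ∎
        cong₃ : ∀ {x x′ y y′ w w′} → x ≡ x′ → y ≡ y′ → w ≡ w′ → x + y * z - w * d ≡ x′ + y′ * z - w′ * d
        cong₃ refl refl refl = refl

    identityII : IdentityII (suc (suc N))
    identityII = combination a b , λ s →
      trans (coeff-identityII s) (sym (CoefficientsAt.coeff-balanced-combination s weights _ (λ _ _ → refl)))

open import Data.Nat using (ℕ; suc; _≤_; _∸_; _*_; z≤n; s≤s)
open import Data.Nat.Divisibility using (_∣_; divides; ∣m+n∣m⇒∣n)
open import Data.Integer using (+_)
open import Data.Rational using (_/_)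
open import Data.Product using (_×_; _,_)
open import Relation.Binary.PropositionalEquality using (refl)
open DoubleEisensteinRelations using (IdentityI; IdentityII; module FirstIdentity; module SecondIdentity)

corollary4p2 :
    (∀ (k : ℕ) → 2 ∣ k → 4 ≤ k →
      ⟦ G¹ (k ∸ 1) 1 ⟧ ≈[ k ]
        ((+ (suc k) / 2) · ⟦ G¹ k 0 ⟧)
        ⊖ (Σ[ evensIn 2 (k ∸ 2) ] λ k₁ → ⟦ Pˢ k₁ (k ∸ k₁) 0 0 ⟧))
    ×
    (∀ (k : ℕ) → 2 ∣ k → 6 ≤ k →
      ((+ (suc k * (k ∸ 1) * (k ∸ 6)) / 12) · ⟦ G¹ k 0 ⟧) ≈[ k ]
        (Σ[ evensIn 4 (k ∸ 4) ] λ k₁ →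
           ℕ→ℚ ((k₁ ∸ 1) * (k ∸ k₁ ∸ 1)) · ⟦ Pˢ k₁ (k ∸ k₁) 0 0 ⟧))
corollary4p2 = first , second
  where
  first : ∀ k → 2 ∣ k → 4 ≤ k → IdentityI k
  first _ 2∣4+M (s≤s (s≤s (s≤s (s≤s z≤n)))) =
    FirstIdentity.identityI (∣m+n∣m⇒∣n 2∣4+M (divides 1 refl)) (s≤s z≤n)
  second : ∀ k → 2 ∣ k → 6 ≤ k → IdentityII k
  second _ 2∣6+M (s≤s (s≤s (s≤s (s≤s (s≤s (s≤s z≤n)))))) =
    SecondIdentity.identityII (∣m+n∣m⇒∣n 2∣6+M (divides 3 refl))
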